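{- Let $B\in(0,1)$, let $q\geq 3$ be an integer and let $\epsilon\in(0,1)$. Let $G=(V,E)$ be a graph and $\mu_G$ the Potts distribution on $G$ with parameter $B$. Suppose $u,v$ are vertices with $\{u,v\}\notin E$ and $\mathbf{E}[\mathsf{Corr}_G(U_\sigma,u,v)]\leq\epsilon$, where the expectation is over $\sigma\sim\mu_G$ and over the random choice of $U_\sigma$. Let $G'$ be obtained from $G$ by adding the edge $\{u,v\}$. Sample $\sigma':V\to[q]$ as follows: sample $\sigma\sim\mu_G$; if $\sigma_u\neq\sigma_v$ set $\sigma'=\sigma$, otherwise set $\sigma'=\textsc{IdealReSample}(G,u,v,\sigma)$. Then the distribution $\nu_{\sigma'}$ of $\sigma'$ satisfies $\|\nu_{\sigma'}-\mu_{G'}\|_{\mathrm{TV}}\leq 2\epsilon/B$, where $\mu_{G'}$ is the Potts distribution on $G'$ with parameter $B$.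
   Context: Potts distribution: $\mu_G(\sigma)=B^{m(\sigma)}/Z_G$ for $\sigma:V\to[q]$, $m(\sigma)$ the number of monochromatic edges. For a set of two states $\{c,c'\}$, the Ising distribution $\pi^{c,c'}_H$ on a graph $H$ is the same with colour set $\{c,c'\}$; $\pi_H=\pi^{1,2}_H$; $\pi^{c,c'}_{H,u,v}$ is $\pi^{c,c'}_H$ conditioned on $u$ having state $c$ and $v$ having state $c'$. For a configuration $\sigma$ and distinct colours $c_1,c_2$, $\sigma^{ -1}(c_1,c_2)$ is the set of vertices coloured $c_1$ or $c_2$. For $U\subseteq V$ with $u,v\in U$, $\mathsf{Corr}_G(U,u,v)=\Big|\frac{\pi_{G[U]}(\eta_u=1,\eta_v=1)}{\pi_{G[U]}(\eta_u=1,\eta_v=2)}-1\Big|$ with $\eta\sim\pi_{G[U]}$. $U_\sigma$: if $\sigma_u\neq\sigma_v$, $U_\sigma=\sigma^{ -1}(\sigma_u,\sigma_v)$; if $\sigma_u=\sigma_v=c$, $U_\sigma=\sigma^{ -1}(c,c')$ with $c'$ uniform in $[q]\setminus\{c\}$. $\textsc{IdealReSample}(G,u,v,\sigma)$ (for $\sigma_u=\sigma_v=c$): flip a coin with heads probability $\frac{qB}{B+q-1}$; if heads return $\sigma$; otherwise choose $c'$ uniformly from $[q]\setminus\{c\}$, let $U=\sigma^{ -1}(c,c')$, $H=G[U]$, sample $\tau:U\to\{c,c'\}$ from $\pi^{c,c'}_{H,u,v}$, and return $\sigma'$ with $\sigma'_w=\tau_w$ for $w\in U$ and $\sigma'_w=\sigma_w$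 otherwise. -}

module Defs where

open import Level using (0ℓ)
open import Data.Bool using (Bool; true; false; _∧_; _∨_; not; if_then_else_; T)
open import Data.Nat as ℕ using (ℕ; zero; suc)
open import Data.Fin using (Fin; zero; suc; toℕ; _≟_)
open import Data.List using (List; []; _∷_; [_]; map; concatMap; filterᵇ; length; allFin; foldr; cartesianProduct)
open import Data.Product using (_×_; _,_; proj₁; proj₂)
open import Relation.Nullary using (¬_)
open import Relation.Nullary.Decidable using (⌊_⌋)
open import Relation.Binary.PropositionalEquality using (_≡_; _≢_)
open import Relation.Binary.Structures using (IsTotalOrder)
open import Algebra.Structures using (IsCommutativeRing)

-- The paper's parameters
-- B, ε and all probabilities live in ℝ; stdlib has no reals, so we state
-- the result for an arbitrary ordered field, which in particular covers ℝ.
-- ∣_∣ is the absolute value and _⁻¹ the (total) inverse, constrained only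
-- on nonzero arguments.

record OrderedField : Set₁ where
  infixl 6 _+_
  infixl 7 _*_
  infix 4 _≤_
  field
    Carrier : Set
    _+_ _*_ : Carrier → Carrier → Carrier
    -_ : Carrier → Carrier
    0# 1# : Carrier
    _⁻¹ : Carrier → Carrier
    _≤_ : Carrier → Carrier → Set
    ∣_∣ : Carrier → Carrier
    isCommutativeRing : IsCommutativeRing _≡_ _+_ _*_ -_ 0# 1#
    0≢1 : 0# ≢ 1#
    ⁻¹-inverse : ∀ x → x ≢ 0# → x * (x ⁻¹) ≡ 1#
    isTotalOrder : IsTotalOrder _≡_ _≤_
    +-mono-≤ : ∀ x y z → x ≤ y → x + z ≤ y + z
    *-nonneg : ∀ x y → 0# ≤ x → 0# ≤ y → 0# ≤ x * y
    ∣∣-nonneg : ∀ x → 0# ≤ x → ∣ x ∣ ≡ x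
    ∣∣-nonpos : ∀ x → x ≤ 0# → ∣ x ∣ ≡ - x

  _<_ : Carrier → Carrier → Set
  x < y = (x ≤ y) × (x ≢ y)

  _-_ : Carrier → Carrier → Carrier
  x - y = x + (- y)

  _/_ : Carrier → Carrier → Carrier
  x / y = x * (y ⁻¹)

  fromℕ : ℕ → Carrier
  fromℕ zero = 0#
  fromℕ (suc k) = 1# + fromℕ k

  _^_ : Carrier → ℕ → Carrier
  x ^ zero = 1#
  x ^ suc k = x * (x ^ k)

record Graph (n : ℕ) : Set where
  field
    adj : Fin n → Fin n → Bool
    adj-sym : ∀ i j → adj i j ≡ adj j i
    adj-irrefl : ∀ i → adj i i ≡ false

_==_ : ∀ {k} → Fin k → Fin k → Bool
i == j = ⌊ i ≟ j ⌋

allᵇ : ∀ {A : Set} → (A → Bool) → List A → Bool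
allᵇ p = foldr (λ a r → p a ∧ r) true

addEdgeAdj : ∀ {n} → (Fin n → Fin n → Bool) → (u v : Fin n) → Fin n → Fin n → Bool
addEdgeAdj adj u v i j = adj i j ∨ (((i == u) ∧ (j == v)) ∨ ((i == v) ∧ (j == u)))

allFuns : ∀ {A : Set} (n : ℕ) → List A → List (Fin n → A)
allFuns zero xs = [ (λ ()) ]
allFuns (suc n) xs = concatMap (λ a → map (λ f → λ { zero → a ; (suc i) → f i }) (allFuns n xs)) xs

configs : (n q : ℕ) → List (Fin n → Fin q)
configs n q = allFuns n (allFin q)

-- unordered pairs {i,j} of vertices, listed once as i < j
pairs : (n : ℕ) → List (Fin n × Fin n)
pairs n = filterᵇ (λ p → toℕ (proj₁ p) ℕ.<ᵇ toℕ (proj₂ p)) (cartesianProduct (allFin n) (allFin n))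

monoIn : ∀ {n} {C : Set} → (Fin n → Fin n → Bool) → (Fin n → Bool) → (C → C → Bool)
       → (Fin n → C) → ℕ
monoIn {n} adj U eqC ρ =
  length (filterᵇ (λ p → adj (proj₁ p) (proj₂ p) ∧ U (proj₁ p) ∧ U (proj₂ p)
                         ∧ eqC (ρ (proj₁ p)) (ρ (proj₂ p))) (pairs n))

mono : ∀ {n q} → (Fin n → Fin n → Bool) → (Fin n → Fin q) → ℕ
mono adj σ = monoIn adj (λ _ → true) _==_ σ

boolEq : Bool → Bool → Bool
boolEq true true = true
boolEq false false = true
boolEq _ _ = false

module Potts (𝔽 : OrderedField) where
  open OrderedField 𝔽

  Σ[_]_ : ∀ {A : Set} → List A → (A → Carrier) → Carrier
  Σ[ xs ] f = foldr (λ a r → f a + r) 0# xs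

  [_]ᵇ : Bool → Carrier
  [ true ]ᵇ = 1#
  [ false ]ᵇ = 0#

  module _ {n : ℕ} (q : ℕ) (B : Carrier) where

    Z : (Fin n → Fin n → Bool) → Carrier
    Z adj = Σ[ configs n q ] (λ τ → B ^ mono adj τ)

    μ : (Fin n → Fin n → Bool) → (Fin n → Fin q) → Carrier
    μ adj σ = (B ^ mono adj σ) / Z adj

    preimage2 : (Fin n → Fin q) → Fin q → Fin q → Fin n → Bool
    preimage2 σ c₁ c₂ w = (σ w == c₁) ∨ (σ w == c₂)

    -- Ising distribution π_{G[U]} with states {1,2}; a configuration
    -- η : U → {1,2} is represented as η : V → Bool (true = state 1,
    -- false = state 2) with η ≡ false outside U (no extra multiplicity).
    isingConfigs : (Fin n → Bool) → List (Fin n → Bool)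
    isingConfigs U = filterᵇ (λ η → allᵇ (λ w → U w ∨ not (η w)) (allFin n)) (allFuns n (true ∷ false ∷ []))

    isingW : (Fin n → Fin n → Bool) → (Fin n → Bool) → (Fin n → Bool) → Carrier
    isingW adj U η = B ^ monoIn adj U boolEq η

    πUV : (Fin n → Fin n → Bool) → (Fin n → Bool) → Fin n → Fin n → Bool → Bool → Carrier
    πUV adj U u v a b =
      (Σ[ isingConfigs U ] (λ η → [ boolEq (η u) a ∧ boolEq (η v) b ]ᵇ * isingW adj U η))
      / (Σ[ isingConfigs U ] (λ η → isingW adj U η))

    Corr : (Fin n → Fin n → Bool) → (Fin n → Bool) → Fin n → Fin n → Carrier
    Corr adj U u v = ∣ (πUV adj U u v true true / πUV adj U u v true false) - 1# ∣

    otherColours : Fin q → List (Fin q)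
    otherColours c = filterᵇ (λ c' → not (c' == c)) (allFin q)

    -- E[Corr_G(U_σ,u,v)] over σ ∼ μ_G and the random choice of U_σ
    -- (c' uniform in [q]∖{c} when σ_u = σ_v = c)
    ECorr : (Fin n → Fin n → Bool) → Fin n → Fin n → Carrier
    ECorr adj u v = Σ[ configs n q ] (λ σ → μ adj σ *
      (if σ u == σ v
       then (Σ[ otherColours (σ u) ] (λ c' → (1# / fromℕ (q ℕ.∸ 1)) * Corr adj (preimage2 σ (σ u) c') u v))
       else Corr adj (preimage2 σ (σ u) (σ v)) u v))

    -- π^{c,c'}_{H,u,v} with H = G[U], U = σ^{-1}(c,c'), written on whole
    -- colourings σ' : V → [q] that agree with σ outside U (σ' is the
    -- output of IdealReSample in the tails branch):
    -- support: σ' ∈ {c,c'} on U, σ' = σ off U, σ'_u = c, σ'_v = c'.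
    resampleValid : (Fin n → Fin q) → Fin n → Fin n → Fin q → Fin q → (Fin n → Fin q) → Bool
    resampleValid σ u v c c' σ' =
      allᵇ (λ w → if preimage2 σ c c' w then ((σ' w == c) ∨ (σ' w == c')) else (σ' w == σ w)) (allFin n)
      ∧ (σ' u == c) ∧ (σ' v == c')

    resampleW : (Fin n → Fin n → Bool) → (Fin n → Fin q) → Fin n → Fin n → Fin q → Fin q
              → (Fin n → Fin q) → Carrier
    resampleW adj σ u v c c' σ' =
      [ resampleValid σ u v c c' σ' ]ᵇ * (B ^ monoIn adj (preimage2 σ c c') _==_ σ')

    condIsing : (Fin n → Fin n → Bool) → (Fin n → Fin q) → Fin n → Fin n → Fin q → Fin q
              → (Fin n → Fin q) → Carrier
    condIsing adj σ u v c c' σ' =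
      resampleW adj σ u v c c' σ' / (Σ[ configs n q ] (resampleW adj σ u v c c'))

    sameConfig : (Fin n → Fin q) → (Fin n → Fin q) → Carrier
    sameConfig σ σ' = [ allᵇ (λ w → σ w == σ' w) (allFin n) ]ᵇ

    idealReSample : (Fin n → Fin n → Bool) → Fin n → Fin n → (Fin n → Fin q) → (Fin n → Fin q) → Carrier
    idealReSample adj u v σ σ' =
      let h = (fromℕ q * B) / (B + fromℕ (q ℕ.∸ 1)) in
      h * sameConfig σ σ'
      + (1# - h) * (Σ[ otherColours (σ u) ] (λ c' →
          (1# / fromℕ (q ℕ.∸ 1)) * condIsing adj σ u v (σ u) c' σ'))

    ν : (Fin n → Fin n → Bool) → Fin n → Fin n → (Fin n → Fin q) → Carrier
    ν adj u v σ' = Σ[ configs n q ] (λ σ → μ adj σ *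
      (if σ u == σ v then idealReSample adj u v σ σ' else sameConfig σ σ'))

    dTV : ((Fin n → Fin q) → Carrier) → ((Fin n → Fin q) → Carrier) → Carrier
    dTV p p' = (1# / fromℕ 2) * (Σ[ configs n q ] (λ σ → ∣ p σ - p' σ ∣))

module Submission where

-- Let m = μ_G.  Adding uv multiplies the weight of σ by
-- f(σ) = B^[σ u = σ v], so μ_{G'} = (Z_G/Z_{G'})·m·f.  On the other hand
-- ν has an explicit density w.r.t. m: on the diagonal σ u = σ v the step
-- keeps mass heads = (1 + γ)·B, with γ = (1 − heads)/(q − 1); off the
-- diagonal ν(ς) = m(ς)·(1 + γ·ρ(ς)), where ρ(ς) is the Ising correlation
-- ratio on U = ς⁻¹(ς u, ς v) (detailed balance of the resampling move).
-- Hence ν = m·((1 + γ)·f + γ·d) with d = [σ u ≠ σ v]·(ρ − 1), and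
-- ν − μ_{G'} = (a constant)·m·f + γ·m·d.  Since both are probability
-- measures, the constant term is controlled by the error term, giving
-- d_TV(ν, μ_{G'}) ≤ Σ|γ·m·d| ≤ E[Corr] ≤ ε ≤ 2ε/B.

open import Defs
open import Data.Nat as ℕ using (ℕ; zero; suc; _≥_; _∸_; _<ᵇ_; s≤s; z≤n)
open import Data.Fin as Fin using (Fin; zero; suc; toℕ)
open import Data.Bool using (Bool; true; false; not; _∧_; _∨_; if_then_else_)
open import Data.List using (List; []; _∷_; map; concatMap; concat; filterᵇ; _++_; tabulate; allFin; foldr; length; cartesianProduct)
open import Data.Product using (_×_; _,_; proj₁; proj₂)
open import Data.Sum using (_⊎_; inj₁; inj₂)
open import Data.Empty using (⊥-elim)
open import Relation.Nullary using (yes; no)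
open import Relation.Binary.PropositionalEquality using (_≡_; _≢_; refl; sym; trans; cong; cong₂; subst; module ≡-Reasoning)
open import Algebra.Structures using (IsCommutativeSemiring; IsCommutativeRing)
open import Relation.Binary.Structures using (IsTotalOrder)
open import Algebra.Bundles using (CommutativeRing)
import Algebra.Properties.Ring as RingProperties
import Algebra.Solver.CommutativeMonoid as CommutativeMonoidSolver
import Data.Nat.Properties as ℕₚ
open import Data.Nat.Tactic.RingSolver using (solve-∀)
import Data.Fin.Properties as Finₚ

==-refl : ∀ {k} (i : Fin k) → (i == i) ≡ true
==-refl i with i Fin.≟ i
... | yes _ = refl
... | no i≢i = ⊥-elim (i≢i refl)

==-sound : ∀ {k} {i j : Fin k} → (i == j) ≡ true → i ≡ j
==-sound {i = i} {j} e with i Fin.≟ j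
... | yes i≡j = i≡j
==-sound () | no _

==-false : ∀ {k} {i j : Fin k} → i ≢ j → (i == j) ≡ false
==-false {i = i} {j} i≢j with i Fin.≟ j
... | yes i≡j = ⊥-elim (i≢j i≡j)
... | no _ = refl

==-sym : ∀ {k} (i j : Fin k) → (i == j) ≡ (j == i)
==-sym i j with i Fin.≟ j | j Fin.≟ i
... | yes _ | yes _ = refl
... | no _ | no _ = refl
... | yes i≡j | no j≢i = ⊥-elim (j≢i (sym i≡j))
... | no i≢j | yes j≡i = ⊥-elim (i≢j (sym j≡i))

==-suc : ∀ {k} (i j : Fin k) → (Fin.suc i == suc j) ≡ (i == j)
==-suc i j with i Fin.≟ j
... | yes _ = refl
... | no _ = refl

==-view : ∀ {k} (i j : Fin k) → ((i == j) ≡ true × i ≡ j) ⊎ ((i == j) ≡ false × i ≢ j)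
==-view i j with i Fin.≟ j
... | yes i≡j = inj₁ (refl , i≡j)
... | no i≢j = inj₂ (refl , i≢j)

==-separate : ∀ {k} (a b x y : Fin k) → ((x == a) ∨ (x == b)) ≡ true → ((y == a) ∨ (y == b)) ≡ false → (x == y) ≡ false
==-separate a b x y x∈ y∉ with ==-view x y
... | inj₂ (x≠y , _) = x≠y
... | inj₁ (_ , refl) with trans (sym x∈) y∉
... | ()

∧-falseʳ : ∀ a → (a ∧ false) ≡ false
∧-falseʳ true = refl
∧-falseʳ false = refl

∨-trueʳ : ∀ a → (a ∨ true) ≡ true
∨-trueʳ true = refl
∨-trueʳ false = refl

allᵇ-cong : ∀ {A : Set} (xs : List A) {p p' : A → Bool} → (∀ x → p x ≡ p' x) → allᵇ p xs ≡ allᵇ p' xs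
allᵇ-cong [] e = refl
allᵇ-cong (x ∷ xs) e = cong₂ _∧_ (e x) (allᵇ-cong xs e)

allᵇ-tabulate : ∀ {A : Set} n (p : A → Bool) (g : Fin n → A) → allᵇ p (tabulate g) ≡ allᵇ (λ i → p (g i)) (allFin n)
allᵇ-tabulate zero p g = refl
allᵇ-tabulate (suc n) p g = cong (p (g zero) ∧_)
  (trans (allᵇ-tabulate n p (λ i → g (suc i))) (sym (allᵇ-tabulate n (λ i → p (g i)) suc)))

allᵇ-allFin-suc : ∀ n (p : Fin (suc n) → Bool) → allᵇ p (allFin (suc n)) ≡ p zero ∧ allᵇ (λ i → p (suc i)) (allFin n)
allᵇ-allFin-suc n p = cong (p zero ∧_) (allᵇ-tabulate n p suc)

allᵇ-intro : ∀ n (p : Fin n → Bool) → (∀ w → p w ≡ true) → allᵇ p (allFin n) ≡ true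
allᵇ-intro zero p h = refl
allᵇ-intro (suc n) p h rewrite allᵇ-allFin-suc n p | h zero = allᵇ-intro n (λ w → p (suc w)) (λ w → h (suc w))

allᵇ-elim : ∀ n (p : Fin n → Bool) → allᵇ p (allFin n) ≡ true → ∀ w → p w ≡ true
allᵇ-elim (suc n) p e w rewrite allᵇ-allFin-suc n p with p zero in p0
allᵇ-elim (suc n) p e zero | true = p0
allᵇ-elim (suc n) p e (suc w) | true = allᵇ-elim n (λ w → p (suc w)) e w

-- Functions on Fin n → A that respect pointwise equality (all the
-- summands below do; we have no function extensionality).
Ext : ∀ {A D : Set} {n} → ((Fin n → A) → D) → Set
Ext {n = n} F = ∀ τ τ' → (∀ w → τ w ≡ τ' w) → F τ ≡ F τ'

cons : ∀ {A : Set} {n} → A → (Fin n → A) → Fin (suc n) → A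
cons a f zero = a
cons a f (suc i) = f i

-- A commutative semiring whose equality is propositional equality; both
-- ℕ (edge counts) and the ordered field (probabilities) are instances.
record CommSemiring≡ : Set₁ where
  infixl 6 _+_
  infixl 7 _*_
  field
    Carrier : Set
    _+_ _*_ : Carrier → Carrier → Carrier
    0# 1# : Carrier
    isCommutativeSemiring : IsCommutativeSemiring _≡_ _+_ _*_ 0# 1#
  open IsCommutativeSemiring isCommutativeSemiring public hiding (refl; sym; trans; zero)

module FiniteSums (R : CommSemiring≡) where
  open CommSemiring≡ R renaming (Carrier to C)
  open ≡-Reasoning

  Σ : ∀ {A : Set} → List A → (A → C) → C
  Σ xs f = foldr (λ a r → f a + r) 0# xs

  𝟙 : Bool → C
  𝟙 true = 1#
  𝟙 false = 0#

  𝟙-∧ : ∀ a b → 𝟙 (a ∧ b) ≡ 𝟙 a * 𝟙 b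
  𝟙-∧ true b = sym (*-identityˡ _)
  𝟙-∧ false b = sym (zeroˡ _)

  𝟙-∨ : ∀ a b → (a ∧ b) ≡ false → 𝟙 (a ∨ b) ≡ 𝟙 a + 𝟙 b
  𝟙-∨ true false _ = sym (+-identityʳ 1#)
  𝟙-∨ false b _ = sym (+-identityˡ _)

  Σ-cong : ∀ {A : Set} (xs : List A) {f g : A → C} → (∀ x → f x ≡ g x) → Σ xs f ≡ Σ xs g
  Σ-cong [] e = refl
  Σ-cong (x ∷ xs) e = cong₂ _+_ (e x) (Σ-cong xs e)

  Σ-zero : ∀ {A : Set} (xs : List A) {f : A → C} → (∀ x → f x ≡ 0#) → Σ xs f ≡ 0#
  Σ-zero [] e = refl
  Σ-zero (x ∷ xs) e = trans (cong₂ _+_ (e x) (Σ-zero xs e)) (+-identityˡ 0#)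

  Σ-+ : ∀ {A : Set} (xs : List A) (f g : A → C) → Σ xs (λ x → f x + g x) ≡ Σ xs f + Σ xs g
  Σ-+ [] f g = sym (+-identityˡ 0#)
  Σ-+ (x ∷ xs) f g = begin
    (f x + g x) + Σ xs (λ y → f y + g y) ≡⟨ cong ((f x + g x) +_) (Σ-+ xs f g) ⟩
    (f x + g x) + (Σ xs f + Σ xs g)     ≡⟨ +-assoc (f x) (g x) _ ⟩
    f x + (g x + (Σ xs f + Σ xs g))     ≡⟨ cong (f x +_) (x+[y+z]≡y+[x+z] (g x) (Σ xs f) (Σ xs g)) ⟩
    f x + (Σ xs f + (g x + Σ xs g))     ≡⟨ sym (+-assoc (f x) (Σ xs f) _) ⟩
    (f x + Σ xs f) + (g x + Σ xs g)     ∎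
    where
    x+[y+z]≡y+[x+z] : ∀ a b c → a + (b + c) ≡ b + (a + c)
    x+[y+z]≡y+[x+z] a b c = trans (sym (+-assoc a b c)) (trans (cong (_+ c) (+-comm a b)) (+-assoc b a c))

  Σ-*ˡ : ∀ {A : Set} (xs : List A) (k : C) (f : A → C) → Σ xs (λ x → k * f x) ≡ k * Σ xs f
  Σ-*ˡ [] k f = sym (zeroʳ k)
  Σ-*ˡ (x ∷ xs) k f = trans (cong (k * f x +_) (Σ-*ˡ xs k f)) (sym (distribˡ k (f x) (Σ xs f)))

  Σ-*ʳ : ∀ {A : Set} (xs : List A) (k : C) (f : A → C) → Σ xs (λ x → f x * k) ≡ Σ xs f * k
  Σ-*ʳ xs k f = trans (Σ-cong xs (λ x → *-comm (f x) k)) (trans (Σ-*ˡ xs k f) (*-comm k _))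

  Σ-++ : ∀ {A : Set} (xs ys : List A) (f : A → C) → Σ (xs ++ ys) f ≡ Σ xs f + Σ ys f
  Σ-++ [] ys f = sym (+-identityˡ _)
  Σ-++ (x ∷ xs) ys f = trans (cong (f x +_) (Σ-++ xs ys f)) (sym (+-assoc _ _ _))

  Σ-map : ∀ {A B : Set} (g : A → B) (xs : List A) (f : B → C) → Σ (map g xs) f ≡ Σ xs (λ x → f (g x))
  Σ-map g [] f = refl
  Σ-map g (x ∷ xs) f = cong (f (g x) +_) (Σ-map g xs f)

  Σ-concatMap : ∀ {A B : Set} (g : A → List B) (xs : List A) (f : B → C) →
                Σ (concatMap g xs) f ≡ Σ xs (λ x → Σ (g x) f)
  Σ-concatMap g [] f = refl
  Σ-concatMap g (x ∷ xs) f = trans (Σ-++ (g x) (concat (map g xs)) f) (cong (Σ (g x) f +_) (Σ-concatMap g xs f))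

  Σ-swap : ∀ {A B : Set} (xs : List A) (ys : List B) (f : A → B → C) →
           Σ xs (λ x → Σ ys (λ y → f x y)) ≡ Σ ys (λ y → Σ xs (λ x → f x y))
  Σ-swap [] ys f = sym (Σ-zero ys (λ _ → refl))
  Σ-swap (x ∷ xs) ys f = trans (cong (Σ ys (f x) +_) (Σ-swap xs ys f))
                              (sym (Σ-+ ys (f x) (λ y → Σ xs (λ x' → f x' y))))

  Σ-filter : ∀ {A : Set} (p : A → Bool) (xs : List A) (f : A → C) →
             Σ (filterᵇ p xs) f ≡ Σ xs (λ x → 𝟙 (p x) * f x)
  Σ-filter p [] f = refl
  Σ-filter p (x ∷ xs) f with p x
  ... | true = cong₂ _+_ (sym (*-identityˡ (f x))) (Σ-filter p xs f)
  ... | false = trans (Σ-filter p xs f) (trans (sym (+-identityˡ _)) (cong (_+ Σ xs (λ y → 𝟙 (p y) * f y)) (sym (zeroˡ (f x)))))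

  Σ-cartesianProduct : ∀ {A B : Set} (xs : List A) (ys : List B) (h : A × B → C) →
                       Σ (cartesianProduct xs ys) h ≡ Σ xs (λ x → Σ ys (λ y → h (x , y)))
  Σ-cartesianProduct [] ys h = refl
  Σ-cartesianProduct (x ∷ xs) ys h =
    trans (Σ-++ (map (x ,_) ys) _ h) (cong₂ _+_ (Σ-map (x ,_) ys h) (Σ-cartesianProduct xs ys h))

  Σ-tabulate : ∀ {A : Set} n (g : Fin n → A) (f : A → C) → Σ (tabulate g) f ≡ Σ (allFin n) (λ i → f (g i))
  Σ-tabulate zero g f = refl
  Σ-tabulate (suc n) g f = cong (f (g zero) +_)
    (trans (Σ-tabulate n (λ i → g (suc i)) f) (sym (Σ-tabulate n suc (λ i → f (g i)))))

  Σ-allFin-suc : ∀ n (f : Fin (suc n) → C) → Σ (allFin (suc n)) f ≡ f zero + Σ (allFin n) (λ i → f (suc i))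
  Σ-allFin-suc n f = cong (f zero +_) (Σ-tabulate n suc f)

  Σ-δ : ∀ k (a : Fin k) (g : Fin k → C) → Σ (allFin k) (λ x → 𝟙 (x == a) * g x) ≡ g a
  Σ-δ (suc k) zero g = begin
    Σ (allFin (suc k)) (λ x → 𝟙 (x == zero) * g x)           ≡⟨ Σ-allFin-suc k _ ⟩
    1# * g zero + Σ (allFin k) (λ x → 0# * g (suc x))       ≡⟨ cong₂ _+_ (*-identityˡ _) (Σ-zero (allFin k) (λ x → zeroˡ _)) ⟩
    g zero + 0#                                               ≡⟨ +-identityʳ _ ⟩
    g zero                                                    ∎
  Σ-δ (suc k) (suc a) g = begin
    Σ (allFin (suc k)) (λ x → 𝟙 (x == suc a) * g x)
      ≡⟨ Σ-allFin-suc k _ ⟩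
    0# * g zero + Σ (allFin k) (λ x → 𝟙 (Fin.suc x == suc a) * g (suc x))
      ≡⟨ cong₂ _+_ (zeroˡ _) (Σ-cong (allFin k) (λ x → cong (λ b → 𝟙 b * g (suc x)) (==-suc x a))) ⟩
    0# + Σ (allFin k) (λ x → 𝟙 (x == a) * g (suc x))
      ≡⟨ +-identityˡ _ ⟩
    Σ (allFin k) (λ x → 𝟙 (x == a) * g (suc x))
      ≡⟨ Σ-δ k a (λ x → g (suc x)) ⟩
    g (suc a) ∎

  Σ-δ' : ∀ k (a : Fin k) (g : Fin k → C) → Σ (allFin k) (λ x → 𝟙 (a == x) * g x) ≡ g a
  Σ-δ' k a g = trans (Σ-cong (allFin k) (λ x → cong (λ b → 𝟙 b * g x) (==-sym a x))) (Σ-δ k a g)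

  Σ-support₁ : ∀ k (a : Fin k) (f : Fin k → C) → (∀ x → (a == x) ≡ false → f x ≡ 0#) → Σ (allFin k) f ≡ f a
  Σ-support₁ k a f outside = trans (Σ-cong (allFin k) δ-form) (Σ-δ' k a f)
    where
    δ-form : ∀ x → f x ≡ 𝟙 (a == x) * f x
    δ-form x with ==-view a x
    ... | inj₁ (a=x , _) rewrite a=x = sym (*-identityˡ _)
    ... | inj₂ (a≠x , _) rewrite a≠x = trans (outside x a≠x) (sym (zeroˡ _))

  Σ-allFuns-suc : ∀ {A : Set} n (xs : List A) (F : (Fin (suc n) → A) → C) → Ext F →
    Σ (allFuns (suc n) xs) F ≡ Σ xs (λ a → Σ (allFuns n xs) (λ f → F (cons a f)))
  Σ-allFuns-suc n xs F ext = trans (Σ-concatMap _ xs F)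
    (Σ-cong xs (λ a → trans (Σ-map _ (allFuns n xs) F)
       (Σ-cong (allFuns n xs) (λ f → ext _ _ (λ { zero → refl ; (suc i) → refl })))))

  reindex : ∀ n {A B : Set} (xs : List A) (ys : List B)
    (P : Fin n → A → Bool) (Q : Fin n → B → Bool) (e : Fin n → B → A) →
    (∀ w (g : A → C) → Σ xs (λ x → 𝟙 (P w x) * g x) ≡ Σ ys (λ y → 𝟙 (Q w y) * g (e w y))) →
    (F : (Fin n → A) → C) → Ext F →
    Σ (allFuns n xs) (λ τ → 𝟙 (allᵇ (λ w → P w (τ w)) (allFin n)) * F τ)
      ≡ Σ (allFuns n ys) (λ η → 𝟙 (allᵇ (λ w → Q w (η w)) (allFin n)) * F (λ w → e w (η w)))
  reindex zero xs ys P Q e coord F ext = cong (λ z → 1# * z + 0#) (ext _ _ (λ ()))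
  reindex (suc n) {A} {B} xs ys P Q e coord F ext = begin
    Σ (allFuns (suc n) xs) (λ τ → 𝟙 (allP τ) * F τ)
      ≡⟨ Σ-allFuns-suc n xs _ P-summand-ext ⟩
    Σ xs (λ a → Σ (allFuns n xs) (λ f → 𝟙 (allP (cons a f)) * F (cons a f)))
      ≡⟨ Σ-cong xs (λ a → trans (Σ-cong (allFuns n xs) (split-P a)) (Σ-*ˡ (allFuns n xs) (𝟙 (P zero a)) _)) ⟩
    Σ xs (λ a → 𝟙 (P zero a) * rest a)
      ≡⟨ coord zero rest ⟩
    Σ ys (λ y → 𝟙 (Q zero y) * rest (e zero y))
      ≡⟨ Σ-cong ys (λ y → cong (𝟙 (Q zero y) *_) (rest-reindexed (e zero y))) ⟩
    Σ ys (λ y → 𝟙 (Q zero y) * Σ (allFuns n ys) (λ η → 𝟙 (allQ' η) * F (cons (e zero y) (λ w → e (suc w) (η w)))))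
      ≡⟨ Σ-cong ys (λ y → trans (sym (Σ-*ˡ (allFuns n ys) (𝟙 (Q zero y)) _)) (Σ-cong (allFuns n ys) (merge-Q y))) ⟩
    Σ ys (λ y → Σ (allFuns n ys) (λ η → 𝟙 (allQ (cons y η)) * F (λ w → e w (cons y η w))))
      ≡⟨ sym (Σ-allFuns-suc n ys _ Q-summand-ext) ⟩
    Σ (allFuns (suc n) ys) (λ η → 𝟙 (allQ η) * F (λ w → e w (η w))) ∎
    where
    allP : (Fin (suc n) → A) → Bool
    allP τ = allᵇ (λ w → P w (τ w)) (allFin (suc n))
    allQ : (Fin (suc n) → B) → Bool
    allQ η = allᵇ (λ w → Q w (η w)) (allFin (suc n))
    allQ' : (Fin n → B) → Bool
    allQ' η = allᵇ (λ w → Q (suc w) (η w)) (allFin n)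
    P-summand-ext : Ext (λ τ → 𝟙 (allP τ) * F τ)
    P-summand-ext τ τ' eq = cong₂ _*_ (cong 𝟙 (allᵇ-cong (allFin (suc n)) (λ w → cong (P w) (eq w)))) (ext τ τ' eq)
    Q-summand-ext : Ext (λ η → 𝟙 (allQ η) * F (λ w → e w (η w)))
    Q-summand-ext η η' eq = cong₂ _*_ (cong 𝟙 (allᵇ-cong (allFin (suc n)) (λ w → cong (Q w) (eq w))))
                                      (ext _ _ (λ w → cong (e w) (eq w)))
    peel : ∀ b c x → 𝟙 (b ∧ c) * x ≡ 𝟙 b * (𝟙 c * x)
    peel b c x = trans (cong (_* x) (𝟙-∧ b c)) (*-assoc _ _ _)
    split-P : ∀ a f → 𝟙 (allP (cons a f)) * F (cons a f)
                    ≡ 𝟙 (P zero a) * (𝟙 (allᵇ (λ w → P (suc w) (f w)) (allFin n)) * F (cons a f))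
    split-P a f = trans (cong (λ b → 𝟙 b * F (cons a f)) (allᵇ-allFin-suc n (λ w → P w (cons a f w)))) (peel (P zero a) _ _)
    merge-Q : ∀ y η → 𝟙 (Q zero y) * (𝟙 (allQ' η) * F (cons (e zero y) (λ w → e (suc w) (η w))))
                    ≡ 𝟙 (allQ (cons y η)) * F (λ w → e w (cons y η w))
    merge-Q y η = trans (sym (peel (Q zero y) _ _))
                    (cong₂ (λ b z → 𝟙 b * z) (sym (allᵇ-allFin-suc n (λ w → Q w (cons y η w))))
                                          (ext _ _ (λ { zero → refl ; (suc i) → refl })))
    rest : A → C
    rest a = Σ (allFuns n xs) (λ f → 𝟙 (allᵇ (λ w → P (suc w) (f w)) (allFin n)) * F (cons a f))
    rest-reindexed : ∀ a → rest a ≡ Σ (allFuns n ys) (λ η → 𝟙 (allQ' η) * F (cons a (λ w → e (suc w) (η w))))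
    rest-reindexed a = reindex n xs ys (λ w → P (suc w)) (λ w → Q (suc w)) (λ w → e (suc w)) (λ w → coord (suc w))
                         (λ f → F (cons a f)) (λ τ τ' eq → ext _ _ (λ { zero → refl ; (suc i) → eq i }))

  Σ-allFuns-point : ∀ n {k} (τ₀ : Fin n → Fin k) (F : (Fin n → Fin k) → C) → Ext F →
    Σ (allFuns n (allFin k)) (λ τ → 𝟙 (allᵇ (λ w → τ w == τ₀ w) (allFin n)) * F τ) ≡ F τ₀
  Σ-allFuns-point zero τ₀ F ext = trans (+-identityʳ _) (trans (*-identityˡ _) (ext _ _ (λ ())))
  Σ-allFuns-point (suc n) {k} τ₀ F ext = begin
    Σ (allFuns (suc n) (allFin k)) (λ τ → 𝟙 (same τ₀ τ) * F τ)
      ≡⟨ Σ-allFuns-suc n (allFin k) _ summand-ext ⟩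
    Σ (allFin k) (λ a → Σ (allFuns n (allFin k)) (λ f → 𝟙 (same τ₀ (cons a f)) * F (cons a f)))
      ≡⟨ Σ-cong (allFin k) (λ a → trans (Σ-cong (allFuns n (allFin k)) (split-head a)) (Σ-*ˡ (allFuns n (allFin k)) (𝟙 (a == τ₀ zero)) _)) ⟩
    Σ (allFin k) (λ a → 𝟙 (a == τ₀ zero) * Σ (allFuns n (allFin k)) (λ f → 𝟙 (allᵇ (λ w → f w == τ₀ (suc w)) (allFin n)) * F (cons a f)))
      ≡⟨ Σ-δ k (τ₀ zero) _ ⟩
    Σ (allFuns n (allFin k)) (λ f → 𝟙 (allᵇ (λ w → f w == τ₀ (suc w)) (allFin n)) * F (cons (τ₀ zero) f))
      ≡⟨ Σ-allFuns-point n (λ w → τ₀ (suc w)) (λ f → F (cons (τ₀ zero) f)) (λ τ τ' eq → ext _ _ (λ { zero → refl ; (suc i) → eq i })) ⟩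
    F (cons (τ₀ zero) (λ w → τ₀ (suc w)))
      ≡⟨ ext _ _ (λ { zero → refl ; (suc i) → refl }) ⟩
    F τ₀ ∎
    where
    same : ∀ {m} → (Fin m → Fin k) → (Fin m → Fin k) → Bool
    same {m} τ₀ τ = allᵇ (λ w → τ w == τ₀ w) (allFin m)
    summand-ext : Ext (λ τ → 𝟙 (same τ₀ τ) * F τ)
    summand-ext τ τ' eq = cong₂ (λ b z → 𝟙 b * z) (allᵇ-cong (allFin (suc n)) (λ w → cong (_== τ₀ w) (eq w))) (ext τ τ' eq)
    split-head : ∀ a f → 𝟙 (same τ₀ (cons a f)) * F (cons a f)
                       ≡ 𝟙 (a == τ₀ zero) * (𝟙 (allᵇ (λ w → f w == τ₀ (suc w)) (allFin n)) * F (cons a f))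
    split-head a f = trans (cong (λ b → 𝟙 b * F (cons a f)) (allᵇ-allFin-suc n (λ w → cons a f w == τ₀ w)))
                           (trans (cong (_* F (cons a f)) (𝟙-∧ (a == τ₀ zero) _)) (*-assoc _ _ _))

module OrderedFieldFacts (𝔽 : OrderedField) where
  open OrderedField 𝔽 public
  open IsCommutativeRing isCommutativeRing public hiding (refl; sym; trans; zero; _-_)
  open IsTotalOrder isTotalOrder public using (total; antisym) renaming (refl to ≤-refl; trans to ≤-trans)
  open ≡-Reasoning

  commutativeRing : CommutativeRing _ _
  commutativeRing = record { isCommutativeRing = isCommutativeRing }

  open RingProperties (CommutativeRing.ring commutativeRing) public
    using (-‿involutive; -0#≈0#; -‿distribˡ-*; -‿distribʳ-*; +-inverseʳ-unique; -‿+-comm; +-cancelʳ)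

  open CommutativeMonoidSolver (CommutativeRing.*-commutativeMonoid commutativeRing) public
    using () renaming (solve to *-solve; _⊕_ to _⊛_; _⊜_ to _⊜_)
  open CommutativeMonoidSolver (CommutativeRing.+-commutativeMonoid commutativeRing) public
    using () renaming (solve to +-solve; _⊕_ to _⊞_; _⊜_ to _⊜⁺_)

  semiring : CommSemiring≡
  semiring = record { isCommutativeSemiring = isCommutativeSemiring }

  open FiniteSums semiring public

  []ᵇ≡𝟙 : ∀ b → Potts.[_]ᵇ 𝔽 b ≡ 𝟙 b
  []ᵇ≡𝟙 true = refl
  []ᵇ≡𝟙 false = refl

  x*[y*z]≡y*[x*z] : ∀ x y z → x * (y * z) ≡ y * (x * z)
  x*[y*z]≡y*[x*z] x y z = trans (sym (*-assoc x y z)) (trans (cong (_* z) (*-comm x y)) (*-assoc y x z))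

  ≤-reflexive : ∀ {x y} → x ≡ y → x ≤ y
  ≤-reflexive refl = ≤-refl

  ≤-resp : ∀ {x y x' y'} → x ≡ x' → y ≡ y' → x ≤ y → x' ≤ y'
  ≤-resp refl refl p = p

  +-monoʳ-≤ : ∀ {x y} z → x ≤ y → z + x ≤ z + y
  +-monoʳ-≤ {x} {y} z p = ≤-resp (+-comm x z) (+-comm y z) (+-mono-≤ x y z p)

  +-mono₂-≤ : ∀ {x y x' y'} → x ≤ y → x' ≤ y' → x + x' ≤ y + y'
  +-mono₂-≤ {x} {y} {x'} p p' = ≤-trans (+-mono-≤ x y x' p) (+-monoʳ-≤ y p')

  ≤⇒0≤- : ∀ {x y} → x ≤ y → 0# ≤ y - x
  ≤⇒0≤- {x} {y} p = ≤-resp (-‿inverseʳ x) refl (+-mono-≤ x y (- x) p)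

  0≤-⇒≤ : ∀ {x y} → 0# ≤ y - x → x ≤ y
  0≤-⇒≤ {x} {y} p = ≤-resp (+-identityˡ x) y-x+x≡y (+-mono-≤ 0# (y - x) x p)
    where y-x+x≡y : y - x + x ≡ y
          y-x+x≡y = trans (+-assoc y (- x) x) (trans (cong (y +_) (-‿inverseˡ x)) (+-identityʳ y))

  neg-antitone : ∀ {x y} → x ≤ y → - y ≤ - x
  neg-antitone {x} {y} p = 0≤-⇒≤ (≤-resp refl (trans (+-comm y (- x)) (cong (- x +_) (sym (-‿involutive y)))) (≤⇒0≤- p))

  0≤⇒-≤0 : ∀ {x} → 0# ≤ x → - x ≤ 0#
  0≤⇒-≤0 p = ≤-resp refl -0#≈0# (neg-antitone p)

  ≤0⇒0≤- : ∀ {x} → x ≤ 0# → 0# ≤ - x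
  ≤0⇒0≤- p = ≤-resp -0#≈0# refl (neg-antitone p)

  *-monoʳ-≤ : ∀ {x y} z → 0# ≤ z → x ≤ y → x * z ≤ y * z
  *-monoʳ-≤ {x} {y} z 0≤z p = 0≤-⇒≤ (≤-resp refl [y-x]z (*-nonneg (y - x) z (≤⇒0≤- p) 0≤z))
    where [y-x]z : (y - x) * z ≡ (y * z) - (x * z)
          [y-x]z = trans (distribʳ z y (- x)) (cong (y * z +_) (sym (-‿distribˡ-* x z)))

  *-monoˡ-≤ : ∀ {x y} z → 0# ≤ z → x ≤ y → z * x ≤ z * y
  *-monoˡ-≤ {x} {y} z 0≤z p = ≤-resp (*-comm x z) (*-comm y z) (*-monoʳ-≤ z 0≤z p)

  0≤1 : 0# ≤ 1#
  0≤1 with total 0# 1#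
  ... | inj₁ p = p
  ... | inj₂ p = ≤-resp refl -1*-1≡1 (*-nonneg (- 1#) (- 1#) (≤0⇒0≤- p) (≤0⇒0≤- p))
    where -1*-1≡1 : - 1# * - 1# ≡ 1#
          -1*-1≡1 = trans (sym (-‿distribˡ-* 1# (- 1#))) (trans (cong -_ (*-identityˡ (- 1#))) (-‿involutive 1#))

  0<1 : 0# < 1#
  0<1 = 0≤1 , 0≢1

  +-nonneg : ∀ {x y} → 0# ≤ x → 0# ≤ y → 0# ≤ x + y
  +-nonneg p q = ≤-resp (+-identityˡ 0#) refl (+-mono₂-≤ p q)

  fromℕ-nonneg : ∀ k → 0# ≤ fromℕ k
  fromℕ-nonneg zero = ≤-refl
  fromℕ-nonneg (suc k) = +-nonneg 0≤1 (fromℕ-nonneg k)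

  fromℕ-≥1 : ∀ k → k ≥ 1 → 1# ≤ fromℕ k
  fromℕ-≥1 (suc k) _ = ≤-resp (+-identityʳ 1#) refl (+-monoʳ-≤ 1# (fromℕ-nonneg k))

  pos⇒≢0 : ∀ {x} → 0# < x → x ≢ 0#
  pos⇒≢0 (_ , 0≢x) x≡0 = 0≢x (sym x≡0)

  <-≤-trans : ∀ {x y} → 0# < x → x ≤ y → 0# < y
  <-≤-trans (0≤x , 0≢x) x≤y = ≤-trans 0≤x x≤y , λ 0≡y → 0≢x (antisym 0≤x (≤-resp refl (sym 0≡y) x≤y))

  x*y⁻¹*y≡x : ∀ x y → y ≢ 0# → x * y ⁻¹ * y ≡ x
  x*y⁻¹*y≡x x y y≢0 = trans (*-assoc x _ y) (trans (cong (x *_) (trans (*-comm _ y) (⁻¹-inverse y y≢0))) (*-identityʳ x))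

  x*y*y⁻¹≡x : ∀ x y → y ≢ 0# → x * y * y ⁻¹ ≡ x
  x*y*y⁻¹≡x x y y≢0 = trans (*-assoc x y _) (trans (cong (x *_) (⁻¹-inverse y y≢0)) (*-identityʳ x))

  ⁻¹-inverseˡ : ∀ x → x ≢ 0# → x ⁻¹ * x ≡ 1#
  ⁻¹-inverseˡ x x≢0 = trans (*-comm _ x) (⁻¹-inverse x x≢0)

  *-cancelʳ : ∀ {x y} z → z ≢ 0# → x * z ≡ y * z → x ≡ y
  *-cancelʳ {x} {y} z z≢0 e = trans (sym (x*y*y⁻¹≡x x z z≢0)) (trans (cong (_* z ⁻¹) e) (x*y*y⁻¹≡x y z z≢0))

  *-pos : ∀ {x y} → 0# < x → 0# < y → 0# < (x * y)
  *-pos {x} {y} (0≤x , 0≢x) (0≤y , 0≢y) =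
    *-nonneg x y 0≤x 0≤y , λ 0≡xy → 0≢x (trans (sym (zeroˡ (y ⁻¹))) (trans (cong (_* y ⁻¹) 0≡xy) (x*y*y⁻¹≡x x y (λ y≡0 → 0≢y (sym y≡0)))))

  ^-pos : ∀ {x} → 0# < x → ∀ k → 0# < (x ^ k)
  ^-pos p zero = 0<1
  ^-pos p (suc k) = *-pos p (^-pos p k)

  ^-+ : ∀ x a b → (x ^ (a ℕ.+ b)) ≡ (x ^ a) * (x ^ b)
  ^-+ x zero b = sym (*-identityˡ _)
  ^-+ x (suc a) b = trans (cong (x *_) (^-+ x a b)) (sym (*-assoc x _ _))

  ⁻¹-pos : ∀ {x} → 0# < x → 0# < (x ⁻¹)
  ⁻¹-pos {x} (0≤x , 0≢x) with total 0# (x ⁻¹)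
  ... | inj₁ p = p , λ 0≡x⁻¹ → 0≢1 (trans (sym (zeroʳ x)) (trans (cong (x *_) 0≡x⁻¹) (⁻¹-inverse x x≢0)))
    where x≢0 = λ x≡0 → 0≢x (sym x≡0)
  ... | inj₂ p = ⊥-elim (0≢1 (antisym 0≤1 (≤-resp (⁻¹-inverse x x≢0) refl x*x⁻¹≤0)))
    where
    x≢0 = λ x≡0 → 0≢x (sym x≡0)
    x*x⁻¹≤0 : x * x ⁻¹ ≤ 0#
    x*x⁻¹≤0 = ≤-resp (-‿involutive _) -0#≈0#
                (neg-antitone (≤-resp refl (sym (-‿distribʳ-* x (x ⁻¹))) (*-nonneg x (- (x ⁻¹)) 0≤x (≤0⇒0≤- p))))

  ⁻¹-nonneg : ∀ {x} → 0# < x → 0# ≤ (x ⁻¹)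
  ⁻¹-nonneg p = proj₁ (⁻¹-pos p)

  /-cancel : ∀ x y z → y ≢ 0# → z ≢ 0# → (x * z ⁻¹) * (y * z ⁻¹) ⁻¹ ≡ x * y ⁻¹
  /-cancel x y z y≢0 z≢0 = *-cancelʳ (y * z ⁻¹) yz⁻¹≢0 (begin
    (x * z ⁻¹) * (y * z ⁻¹) ⁻¹ * (y * z ⁻¹) ≡⟨ x*y⁻¹*y≡x (x * z ⁻¹) (y * z ⁻¹) yz⁻¹≢0 ⟩
    x * z ⁻¹                                ≡⟨ cong (_* z ⁻¹) (sym (x*y⁻¹*y≡x x y y≢0)) ⟩
    x * y ⁻¹ * y * z ⁻¹                     ≡⟨ *-assoc (x * y ⁻¹) y (z ⁻¹) ⟩
    x * y ⁻¹ * (y * z ⁻¹)                   ∎)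
    where
    yz⁻¹≢0 : y * z ⁻¹ ≢ 0#
    yz⁻¹≢0 e = y≢0 (trans (sym (x*y⁻¹*y≡x y z z≢0)) (trans (cong (_* z) e) (zeroˡ z)))

  ∣x∣-view : ∀ x → (0# ≤ x × ∣ x ∣ ≡ x) ⊎ (x ≤ 0# × ∣ x ∣ ≡ - x)
  ∣x∣-view x with total 0# x
  ... | inj₁ p = inj₁ (p , ∣∣-nonneg x p)
  ... | inj₂ p = inj₂ (p , ∣∣-nonpos x p)

  ∣x∣-nonneg : ∀ x → 0# ≤ ∣ x ∣
  ∣x∣-nonneg x with ∣x∣-view x
  ... | inj₁ (p , e) = ≤-resp refl (sym e) p
  ... | inj₂ (p , e) = ≤-resp refl (sym e) (≤0⇒0≤- p)

  x≤∣x∣ : ∀ x → x ≤ ∣ x ∣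
  x≤∣x∣ x with ∣x∣-view x
  ... | inj₁ (p , e) = ≤-reflexive (sym e)
  ... | inj₂ (p , e) = ≤-trans p (≤-resp refl (sym e) (≤0⇒0≤- p))

  -x≤∣x∣ : ∀ x → - x ≤ ∣ x ∣
  -x≤∣x∣ x with ∣x∣-view x
  ... | inj₁ (p , e) = ≤-trans (0≤⇒-≤0 p) (≤-resp refl (sym e) p)
  ... | inj₂ (p , e) = ≤-reflexive (sym e)

  ∣∣-triangle : ∀ x y → ∣ x + y ∣ ≤ ∣ x ∣ + ∣ y ∣
  ∣∣-triangle x y with ∣x∣-view (x + y)
  ... | inj₁ (p , e) = ≤-resp (sym e) refl (+-mono₂-≤ (x≤∣x∣ x) (x≤∣x∣ y))
  ... | inj₂ (p , e) = ≤-resp (trans (-‿+-comm x y) (sym e)) refl (+-mono₂-≤ (-x≤∣x∣ x) (-x≤∣x∣ y))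

  ∣-x∣≡∣x∣ : ∀ x → ∣ - x ∣ ≡ ∣ x ∣
  ∣-x∣≡∣x∣ x with ∣x∣-view x
  ... | inj₁ (p , e) = trans (∣∣-nonpos (- x) (0≤⇒-≤0 p)) (trans (-‿involutive x) (sym e))
  ... | inj₂ (p , e) = trans (∣∣-nonneg (- x) (≤0⇒0≤- p)) (sym e)

  ∣c*x∣≡c*∣x∣ : ∀ c x → 0# ≤ c → ∣ c * x ∣ ≡ c * ∣ x ∣
  ∣c*x∣≡c*∣x∣ c x 0≤c with ∣x∣-view x
  ... | inj₁ (p , e) = trans (∣∣-nonneg (c * x) (*-nonneg c x 0≤c p)) (cong (c *_) (sym e))
  ... | inj₂ (p , e) = trans (∣∣-nonpos (c * x) cx≤0) (trans (-‿distribʳ-* c x) (cong (c *_) (sym e)))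
    where cx≤0 : c * x ≤ 0#
          cx≤0 = ≤-resp (-‿involutive _) -0#≈0# (neg-antitone (≤-resp refl (sym (-‿distribʳ-* c x)) (*-nonneg c (- x) 0≤c (≤0⇒0≤- p))))

  𝟙-nonneg : ∀ b → 0# ≤ 𝟙 b
  𝟙-nonneg true = 0≤1
  𝟙-nonneg false = ≤-refl

  𝟙*x≤x : ∀ b x → 0# ≤ x → 𝟙 b * x ≤ x
  𝟙*x≤x true x p = ≤-reflexive (*-identityˡ x)
  𝟙*x≤x false x p = ≤-resp (sym (zeroˡ x)) refl p

  Σ-nonneg : ∀ {A : Set} (xs : List A) (f : A → Carrier) → (∀ x → 0# ≤ f x) → 0# ≤ Σ xs f
  Σ-nonneg [] f p = ≤-refl
  Σ-nonneg (x ∷ xs) f p = +-nonneg (p x) (Σ-nonneg xs f p)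

  Σ-mono : ∀ {A : Set} (xs : List A) (f g : A → Carrier) → (∀ x → f x ≤ g x) → Σ xs f ≤ Σ xs g
  Σ-mono [] f g p = ≤-refl
  Σ-mono (x ∷ xs) f g p = +-mono₂-≤ (p x) (Σ-mono xs f g p)

  Σ-∣∣ : ∀ {A : Set} (xs : List A) (f : A → Carrier) → ∣ Σ xs f ∣ ≤ Σ xs (λ x → ∣ f x ∣)
  Σ-∣∣ [] f = ≤-reflexive (∣∣-nonneg 0# ≤-refl)
  Σ-∣∣ (x ∷ xs) f = ≤-trans (∣∣-triangle (f x) (Σ xs f)) (+-monoʳ-≤ ∣ f x ∣ (Σ-∣∣ xs f))

  Σ-neg : ∀ {A : Set} (xs : List A) (f : A → Carrier) → Σ xs (λ x → - f x) ≡ - Σ xs f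
  Σ-neg [] f = sym -0#≈0#
  Σ-neg (x ∷ xs) f = trans (cong (- f x +_) (Σ-neg xs f)) (-‿+-comm (f x) (Σ xs f))

  Σ-ones : ∀ k → Σ (allFin k) (λ _ → 1#) ≡ fromℕ k
  Σ-ones zero = refl
  Σ-ones (suc k) = trans (Σ-allFin-suc k (λ _ → 1#)) (cong (1# +_) (Σ-ones k))

  Σ-allFuns-≥-point : ∀ n {k} (F : (Fin n → Fin k) → Carrier) → Ext F → (∀ τ → 0# ≤ F τ) →
                      ∀ τ₀ → F τ₀ ≤ Σ (allFuns n (allFin k)) F
  Σ-allFuns-≥-point n {k} F ext F≥0 τ₀ =
    ≤-resp (Σ-allFuns-point n τ₀ F ext) refl
           (Σ-mono (allFuns n (allFin k)) _ F (λ τ → 𝟙*x≤x (allᵇ (λ w → τ w == τ₀ w) (allFin n)) (F τ) (F≥0 τ)))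

  0<2 : 0# < fromℕ 2
  0<2 = <-≤-trans 0<1 (fromℕ-≥1 2 (s≤s z≤n))

  2x≡x+x : ∀ x → fromℕ 2 * x ≡ x + x
  2x≡x+x x = trans (distribʳ x 1# (1# + 0#)) (cong₂ _+_ (*-identityˡ x)
               (trans (distribʳ x 1# 0#) (trans (cong₂ _+_ (*-identityˡ x) (zeroˡ x)) (+-identityʳ x))))

  ½*[x+x]≡x : ∀ x → (1# / fromℕ 2) * (x + x) ≡ x
  ½*[x+x]≡x x = begin
    (1# * fromℕ 2 ⁻¹) * (x + x)     ≡⟨ cong₂ _*_ (*-identityˡ _) (sym (2x≡x+x x)) ⟩
    fromℕ 2 ⁻¹ * (fromℕ 2 * x)      ≡⟨ sym (*-assoc _ _ x) ⟩
    (fromℕ 2 ⁻¹ * fromℕ 2) * x      ≡⟨ cong (_* x) (⁻¹-inverseˡ (fromℕ 2) (pos⇒≢0 0<2)) ⟩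
    1# * x                           ≡⟨ *-identityˡ x ⟩
    x                                ∎

  x≤2x/B : ∀ {x B} → 0# ≤ x → 0# < B → B ≤ 1# → x ≤ (fromℕ 2 * x) / B
  x≤2x/B {x} {B} 0≤x 0<B B≤1 = ≤-trans x≤x/B (*-monoʳ-≤ (B ⁻¹) (⁻¹-nonneg 0<B) x≤2x)
    where
    1≤B⁻¹ : 1# ≤ B ⁻¹
    1≤B⁻¹ = ≤-resp (⁻¹-inverse B (pos⇒≢0 0<B)) (*-identityˡ _) (*-monoʳ-≤ (B ⁻¹) (⁻¹-nonneg 0<B) B≤1)
    x≤x/B : x ≤ x * B ⁻¹
    x≤x/B = ≤-resp (*-identityʳ x) refl (*-monoˡ-≤ x 0≤x 1≤B⁻¹)
    x≤2x : x ≤ fromℕ 2 * x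
    x≤2x = ≤-resp (+-identityʳ x) (sym (2x≡x+x x)) (+-monoʳ-≤ x 0≤x)

module EdgeCounts where

  ℕ-semiring : CommSemiring≡
  ℕ-semiring = record { isCommutativeSemiring = ℕₚ.+-*-isCommutativeSemiring }

  open FiniteSums ℕ-semiring
  open ≡-Reasoning

  length-filter : ∀ {A : Set} (p : A → Bool) (xs : List A) → length (filterᵇ p xs) ≡ Σ xs (λ x → 𝟙 (p x))
  length-filter p [] = refl
  length-filter p (x ∷ xs) with p x
  ... | true = cong suc (length-filter p xs)
  ... | false = length-filter p xs

  filterᵇ-cong : ∀ {A : Set} {p p' : A → Bool} → (∀ x → p x ≡ p' x) → (xs : List A) → filterᵇ p xs ≡ filterᵇ p' xs
  filterᵇ-cong e [] = refl
  filterᵇ-cong {p = p} {p'} e (x ∷ xs) with p x | p' x | e x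
  ... | true | true | refl = cong (x ∷_) (filterᵇ-cong e xs)
  ... | false | false | refl = filterᵇ-cong e xs

  monoIn-cong : ∀ {n} {C C' : Set} (adj : Fin n → Fin n → Bool) {U U' : Fin n → Bool}
    (eq : C → C → Bool) (eq' : C' → C' → Bool) (ρ : Fin n → C) (ρ' : Fin n → C') →
    (∀ w → U w ≡ U' w) →
    (∀ i j → U i ≡ true → U j ≡ true → eq (ρ i) (ρ j) ≡ eq' (ρ' i) (ρ' j)) →
    monoIn adj U eq ρ ≡ monoIn adj U' eq' ρ'
  monoIn-cong {n} adj {U} {U'} eq eq' ρ ρ' U≡U' same-on-U = cong length (filterᵇ-cong edge-counted (pairs n))
    where
    edge-counted : ∀ p → (adj (proj₁ p) (proj₂ p) ∧ U (proj₁ p) ∧ U (proj₂ p) ∧ eq (ρ (proj₁ p)) (ρ (proj₂ p)))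
                       ≡ (adj (proj₁ p) (proj₂ p) ∧ U' (proj₁ p) ∧ U' (proj₂ p) ∧ eq' (ρ' (proj₁ p)) (ρ' (proj₂ p)))
    edge-counted (i , j) rewrite sym (U≡U' i) | sym (U≡U' j) with U i in Ui | U j in Uj
    ... | true | true rewrite same-on-U i j Ui Uj = refl
    ... | true | false = refl
    ... | false | _ = refl

  monoIn-ext : ∀ {n q} (adj : Fin n → Fin n → Bool) (U : Fin n → Bool) {σ σ' : Fin n → Fin q} →
               (∀ w → σ w ≡ σ' w) → monoIn adj U _==_ σ ≡ monoIn adj U _==_ σ'
  monoIn-ext adj U {σ} {σ'} e = monoIn-cong adj {U} {U} _==_ _==_ σ σ' (λ _ → refl) (λ i j _ _ → cong₂ _==_ (e i) (e j))

  module AddEdge {n : ℕ} (G : Graph n) (u v : Fin n) (u≢v : u ≢ v) (uv∉G : Graph.adj G u v ≡ false) where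
    adj = Graph.adj G

    isUV : Fin n → Fin n → Bool
    isUV i j = ((i == u) ∧ (j == v)) ∨ ((i == v) ∧ (j == u))

    lt : Fin n × Fin n → Bool
    lt p = toℕ (proj₁ p) <ᵇ toℕ (proj₂ p)

    Σ-pairs : (h : Fin n × Fin n → ℕ) → Σ (pairs n) h ≡ Σ (allFin n) (λ i → Σ (allFin n) (λ j → 𝟙 (lt (i , j)) ℕ.* h (i , j)))
    Σ-pairs h = trans (Σ-filter lt (cartesianProduct (allFin n) (allFin n)) h) (Σ-cartesianProduct (allFin n) (allFin n) _)

    Σ-δ₂ : ∀ a b (c : ℕ) → Σ (allFin n) (λ i → Σ (allFin n) (λ j → 𝟙 ((i == a) ∧ (j == b)) ℕ.* c)) ≡ c
    Σ-δ₂ a b c = trans (Σ-cong (allFin n) (λ i → trans (Σ-cong (allFin n) (λ j →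
                     trans (cong (ℕ._* c) (𝟙-∧ (i == a) (j == b))) (ℕₚ.*-assoc (𝟙 (i == a)) (𝟙 (j == b)) c)))
                   (trans (Σ-*ˡ (allFin n) (𝟙 (i == a)) _) (cong (𝟙 (i == a) ℕ.*_) (Σ-δ n b (λ _ → c))))))
                 (Σ-δ n a (λ _ → c))

    lt-one-of : 𝟙 (lt (u , v)) ℕ.+ 𝟙 (lt (v , u)) ≡ 1
    lt-one-of = go (toℕ u) (toℕ v) (λ e → u≢v (Finₚ.toℕ-injective e))
      where
      go : ∀ a b → a ≢ b → 𝟙 (a <ᵇ b) ℕ.+ 𝟙 (b <ᵇ a) ≡ 1
      go zero zero a≢b = ⊥-elim (a≢b refl)
      go zero (suc b) _ = refl
      go (suc a) zero _ = refl
      go (suc a) (suc b) a≢b = go a b (λ e → a≢b (cong suc e))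

    lt-δ : ∀ a b i j → 𝟙 (lt (i , j)) ℕ.* 𝟙 ((i == a) ∧ (j == b)) ≡ 𝟙 ((i == a) ∧ (j == b)) ℕ.* 𝟙 (lt (a , b))
    lt-δ a b i j with ==-view i a | ==-view j b
    ... | inj₁ (i=a , refl) | inj₁ (j=b , refl) rewrite i=a | j=b = ℕₚ.*-comm (𝟙 (lt (a , b))) 1
    ... | inj₂ (i≠a , _) | _ rewrite i≠a = ℕₚ.*-zeroʳ (𝟙 (lt (i , j)))
    ... | inj₁ (i=a , _) | inj₂ (j≠b , _) rewrite i=a | j≠b = ℕₚ.*-zeroʳ (𝟙 (lt (i , j)))

    uv-vu-disjoint : ∀ i j → (((i == u) ∧ (j == v)) ∧ ((i == v) ∧ (j == u))) ≡ false
    uv-vu-disjoint i j with ==-view i u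
    ... | inj₂ (i≠u , _) rewrite i≠u = refl
    ... | inj₁ (i=u , refl) rewrite i=u | ==-false u≢v = ∧-falseʳ _

    count-uv : Σ (pairs n) (λ p → 𝟙 (isUV (proj₁ p) (proj₂ p))) ≡ 1
    count-uv = begin
      Σ (pairs n) (λ p → 𝟙 (isUV (proj₁ p) (proj₂ p)))
        ≡⟨ Σ-pairs _ ⟩
      Σ (allFin n) (λ i → Σ (allFin n) (λ j → 𝟙 (lt (i , j)) ℕ.* 𝟙 (isUV i j)))
        ≡⟨ Σ-cong (allFin n) (λ i → trans (Σ-cong (allFin n) (λ j → split i j)) (Σ-+ (allFin n) _ _)) ⟩
      Σ (allFin n) (λ i → Σ (allFin n) (λ j → 𝟙 ((i == u) ∧ (j == v)) ℕ.* 𝟙 (lt (u , v))) ℕ.+ Σ (allFin n) (λ j → 𝟙 ((i == v) ∧ (j == u)) ℕ.* 𝟙 (lt (v , u))))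
        ≡⟨ Σ-+ (allFin n) _ _ ⟩
      Σ (allFin n) (λ i → Σ (allFin n) (λ j → 𝟙 ((i == u) ∧ (j == v)) ℕ.* 𝟙 (lt (u , v))))
        ℕ.+ Σ (allFin n) (λ i → Σ (allFin n) (λ j → 𝟙 ((i == v) ∧ (j == u)) ℕ.* 𝟙 (lt (v , u))))
        ≡⟨ cong₂ ℕ._+_ (Σ-δ₂ u v (𝟙 (lt (u , v)))) (Σ-δ₂ v u (𝟙 (lt (v , u)))) ⟩
      𝟙 (lt (u , v)) ℕ.+ 𝟙 (lt (v , u))
        ≡⟨ lt-one-of ⟩
      1 ∎
      where
      split : ∀ i j → 𝟙 (lt (i , j)) ℕ.* 𝟙 (isUV i j)
                    ≡ 𝟙 ((i == u) ∧ (j == v)) ℕ.* 𝟙 (lt (u , v)) ℕ.+ 𝟙 ((i == v) ∧ (j == u)) ℕ.* 𝟙 (lt (v , u))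
      split i j = trans (cong (𝟙 (lt (i , j)) ℕ.*_) (𝟙-∨ ((i == u) ∧ (j == v)) ((i == v) ∧ (j == u)) (uv-vu-disjoint i j)))
                    (trans (ℕₚ.*-distribˡ-+ (𝟙 (lt (i , j))) (𝟙 ((i == u) ∧ (j == v))) (𝟙 ((i == v) ∧ (j == u)))) (cong₂ ℕ._+_ (lt-δ u v i j) (lt-δ v u i j)))

    isUV-edge : ∀ {q} (σ : Fin n → Fin q) i j → isUV i j ≡ true → adj i j ≡ false × (σ i == σ j) ≡ (σ u == σ v)
    isUV-edge σ i j e with ==-view i u | ==-view j v
    ... | inj₁ (_ , refl) | inj₁ (_ , refl) = uv∉G , refl
    ... | inj₂ (i≠u , _) | _ rewrite i≠u = vu-edge e
      where
      vu-edge : ((i == v) ∧ (j == u)) ≡ true → adj i j ≡ false × (σ i == σ j) ≡ (σ u == σ v)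
      vu-edge e with i == v in i=v | j == u in j=u
      vu-edge refl | true | true with ==-sound i=v | ==-sound j=u
      ... | refl | refl = trans (Graph.adj-sym G v u) uv∉G , ==-sym (σ v) (σ u)
    ... | inj₁ (i=u , _) | inj₂ (j≠v , _) rewrite i=u | j≠v = vu-edge e
      where
      vu-edge : ((i == v) ∧ (j == u)) ≡ true → adj i j ≡ false × (σ i == σ j) ≡ (σ u == σ v)
      vu-edge e with i == v in i=v | j == u in j=u
      vu-edge refl | true | true with ==-sound i=v | ==-sound j=u
      ... | refl | refl = trans (Graph.adj-sym G v u) uv∉G , ==-sym (σ v) (σ u)

    𝟙-add : ∀ (A K E s : Bool) → (K ≡ true → A ≡ false × E ≡ s) → 𝟙 ((A ∨ K) ∧ E) ≡ 𝟙 (A ∧ E) ℕ.+ 𝟙 K ℕ.* 𝟙 s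
    𝟙-add A false E s _ with A
    ... | true = sym (ℕₚ.+-identityʳ _)
    ... | false = refl
    𝟙-add A true E s h with h refl
    ... | refl , refl = sym (ℕₚ.+-identityʳ _)

    mono-addEdge : ∀ {q} (σ : Fin n → Fin q) → mono (addEdgeAdj adj u v) σ ≡ mono adj σ ℕ.+ 𝟙 (σ u == σ v)
    mono-addEdge σ = begin
      mono (addEdgeAdj adj u v) σ
        ≡⟨ length-filter _ (pairs n) ⟩
      Σ (pairs n) (λ p → 𝟙 (addEdgeAdj adj u v (proj₁ p) (proj₂ p) ∧ mono? p))
        ≡⟨ Σ-cong (pairs n) (λ p → 𝟙-add (adj (proj₁ p) (proj₂ p)) (isUV (proj₁ p) (proj₂ p)) _ (σ u == σ v) (isUV-edge σ (proj₁ p) (proj₂ p))) ⟩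
      Σ (pairs n) (λ p → 𝟙 (adj (proj₁ p) (proj₂ p) ∧ mono? p) ℕ.+ 𝟙 (isUV (proj₁ p) (proj₂ p)) ℕ.* 𝟙 (σ u == σ v))
        ≡⟨ Σ-+ (pairs n) _ _ ⟩
      Σ (pairs n) (λ p → 𝟙 (adj (proj₁ p) (proj₂ p) ∧ mono? p)) ℕ.+ Σ (pairs n) (λ p → 𝟙 (isUV (proj₁ p) (proj₂ p)) ℕ.* 𝟙 (σ u == σ v))
        ≡⟨ cong₂ ℕ._+_ (sym (length-filter _ (pairs n))) new-edge ⟩
      mono adj σ ℕ.+ 𝟙 (σ u == σ v) ∎
      where
      mono? : Fin n × Fin n → Bool
      mono? p = σ (proj₁ p) == σ (proj₂ p)
      new-edge : Σ (pairs n) (λ p → 𝟙 (isUV (proj₁ p) (proj₂ p)) ℕ.* 𝟙 (σ u == σ v)) ≡ 𝟙 (σ u == σ v)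
      new-edge = trans (Σ-*ʳ (pairs n) (𝟙 (σ u == σ v)) _) (trans (cong (ℕ._* 𝟙 (σ u == σ v)) count-uv) (ℕₚ.*-identityˡ _))

  𝟙-split : ∀ (a r : Bool) → 𝟙 a ≡ 𝟙 (a ∧ r) ℕ.+ 𝟙 (a ∧ not r)
  𝟙-split true true = refl
  𝟙-split true false = refl
  𝟙-split false r = refl

  -- Recolouring inside U: if σ and σ' agree outside U and both use the
  -- colours {a,b} exactly on U, the monochromatic edges not inside U are
  -- the same for both, so m(σ) − m_U(σ) = m(σ') − m_U(σ').
  mono-recolour : ∀ {n q} (adj : Fin n → Fin n → Bool) (σ σ' : Fin n → Fin q) (U : Fin n → Bool) (a b : Fin q) →
    (∀ w → ((σ w == a) ∨ (σ w == b)) ≡ U w) → (∀ w → ((σ' w == a) ∨ (σ' w == b)) ≡ U w) →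
    (∀ w → U w ≡ false → σ w ≡ σ' w) →
    mono adj σ ℕ.+ monoIn adj U _==_ σ' ≡ mono adj σ' ℕ.+ monoIn adj U _==_ σ
  mono-recolour {n} adj σ σ' U a b σ-U σ'-U agree = begin
    mono adj σ ℕ.+ mU σ'                ≡⟨ cong (ℕ._+ mU σ') (split-U σ) ⟩
    mU σ ℕ.+ outside σ ℕ.+ mU σ'         ≡⟨ cong (λ y → mU σ ℕ.+ y ℕ.+ mU σ') outside-U-same ⟩
    mU σ ℕ.+ outside σ' ℕ.+ mU σ'        ≡⟨ arith (mU σ) (outside σ') (mU σ') ⟩
    mU σ' ℕ.+ outside σ' ℕ.+ mU σ        ≡⟨ cong (ℕ._+ mU σ) (sym (split-U σ')) ⟩
    mono adj σ' ℕ.+ mU σ                 ∎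
    where
    mU : (Fin n → _) → ℕ
    mU τ = monoIn adj U _==_ τ
    arith : ∀ x y z → x ℕ.+ y ℕ.+ z ≡ z ℕ.+ y ℕ.+ x
    arith = solve-∀
    monoEdge : (Fin n → _) → Fin n × Fin n → Bool
    monoEdge τ p = adj (proj₁ p) (proj₂ p) ∧ (τ (proj₁ p) == τ (proj₂ p))
    inside : Fin n × Fin n → Bool
    inside p = U (proj₁ p) ∧ U (proj₂ p)
    outside : (Fin n → _) → ℕ
    outside τ = Σ (pairs n) (λ p → 𝟙 (monoEdge τ p ∧ not (inside p)))
    reassoc : ∀ A Ui Uj E → ((A ∧ E) ∧ (Ui ∧ Uj)) ≡ (A ∧ Ui ∧ Uj ∧ E)
    reassoc true true true true = refl
    reassoc true true true false = refl
    reassoc true true false E = ∧-falseʳ E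
    reassoc true false Uj E = ∧-falseʳ E
    reassoc false Ui Uj E = refl
    split-U : ∀ τ → mono adj τ ≡ monoIn adj U _==_ τ ℕ.+ outside τ
    split-U τ = begin
      mono adj τ
        ≡⟨ length-filter _ (pairs n) ⟩
      Σ (pairs n) (λ p → 𝟙 (monoEdge τ p))
        ≡⟨ Σ-cong (pairs n) (λ p → trans (𝟙-split (monoEdge τ p) (inside p))
                                   (cong (λ b → 𝟙 b ℕ.+ 𝟙 (monoEdge τ p ∧ not (inside p)))
                                         (reassoc (adj (proj₁ p) (proj₂ p)) (U (proj₁ p)) (U (proj₂ p)) (τ (proj₁ p) == τ (proj₂ p))))) ⟩
      Σ (pairs n) (λ p → 𝟙 (adj (proj₁ p) (proj₂ p) ∧ U (proj₁ p) ∧ U (proj₂ p) ∧ (τ (proj₁ p) == τ (proj₂ p))) ℕ.+ 𝟙 (monoEdge τ p ∧ not (inside p)))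
        ≡⟨ Σ-+ (pairs n) (λ p → 𝟙 (adj (proj₁ p) (proj₂ p) ∧ U (proj₁ p) ∧ U (proj₂ p) ∧ (τ (proj₁ p) == τ (proj₂ p)))) _ ⟩
      Σ (pairs n) (λ p → 𝟙 (adj (proj₁ p) (proj₂ p) ∧ U (proj₁ p) ∧ U (proj₂ p) ∧ (τ (proj₁ p) == τ (proj₂ p)))) ℕ.+ outside τ
        ≡⟨ cong (ℕ._+ outside τ) (sym (length-filter _ (pairs n))) ⟩
      monoIn adj U _==_ τ ℕ.+ outside τ ∎
    same-colour-test : ∀ i j → (U i ∧ U j) ≡ false → (σ i == σ j) ≡ (σ' i == σ' j)
    same-colour-test i j r with U i in Ui | U j in Uj
    ... | false | false rewrite agree i Ui | agree j Uj = refl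
    ... | true | false = trans (==-separate a b (σ i) (σ j) (trans (σ-U i) Ui) (trans (σ-U j) Uj))
                          (sym (==-separate a b (σ' i) (σ' j) (trans (σ'-U i) Ui) (trans (σ'-U j) Uj)))
    ... | false | true = trans (==-sym (σ i) (σ j)) (trans (==-separate a b (σ j) (σ i) (trans (σ-U j) Uj) (trans (σ-U i) Ui))
                          (sym (trans (==-sym (σ' i) (σ' j)) (==-separate a b (σ' j) (σ' i) (trans (σ'-U j) Uj) (trans (σ'-U i) Ui)))))
    outside-U-same : outside σ ≡ outside σ'
    outside-U-same = Σ-cong (pairs n) (λ p → cong 𝟙 (edge (proj₁ p) (proj₂ p)))
      where
      edge : ∀ i j → ((adj i j ∧ (σ i == σ j)) ∧ not (U i ∧ U j)) ≡ ((adj i j ∧ (σ' i == σ' j)) ∧ not (U i ∧ U j))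
      edge i j with (U i ∧ U j) in r
      ... | true = trans (∧-falseʳ _) (sym (∧-falseʳ _))
      ... | false rewrite same-colour-test i j r = refl

module PottsModel (𝔽 : OrderedField) {n : ℕ} (q₁ : ℕ) (B : OrderedField.Carrier 𝔽) (0<B : OrderedField._<_ 𝔽 (OrderedField.0# 𝔽) B)
                  (adj : Fin n → Fin n → Bool) (u v : Fin n) (u≢v : u ≢ v) where
  open OrderedFieldFacts 𝔽
  open Potts 𝔽 hiding (Σ[_]_)
  open EdgeCounts using (monoIn-ext)
  open ≡-Reasoning

  q : ℕ
  q = suc q₁

  Config : Set
  Config = Fin n → Fin q

  cfg : List Config
  cfg = configs n q

  B^-nonneg : ∀ k → 0# ≤ (B ^ k)
  B^-nonneg k = proj₁ (^-pos 0<B k)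

  μ-ext : ∀ (adj' : Fin n → Fin n → Bool) → Ext (μ q B adj')
  μ-ext adj' σ σ' e = cong (λ k → (B ^ k) / Z q B adj') (monoIn-ext adj' (λ _ → true) e)

  Z-pos : ∀ (adj' : Fin n → Fin n → Bool) → 0# < Z q B adj'
  Z-pos adj' = <-≤-trans (^-pos 0<B (mono adj' σ₀))
    (Σ-allFuns-≥-point n (λ σ → B ^ mono adj' σ) (λ σ σ' e → cong (B ^_) (monoIn-ext adj' (λ _ → true) e))
                          (λ σ → B^-nonneg (mono adj' σ)) σ₀)
    where σ₀ : Config
          σ₀ _ = zero

  Z≢0 : ∀ (adj' : Fin n → Fin n → Bool) → Z q B adj' ≢ 0#
  Z≢0 adj' = pos⇒≢0 (Z-pos adj')

  μ-nonneg : ∀ (adj' : Fin n → Fin n → Bool) σ → 0# ≤ μ q B adj' σ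
  μ-nonneg adj' σ = *-nonneg _ _ (B^-nonneg (mono adj' σ)) (⁻¹-nonneg (Z-pos adj'))

  Σμ : ∀ (adj' : Fin n → Fin n → Bool) → Σ cfg (μ q B adj') ≡ 1#
  Σμ adj' = trans (Σ-*ʳ cfg (Z q B adj' ⁻¹) (λ σ → B ^ mono adj' σ)) (⁻¹-inverse _ (Z≢0 adj'))

  Σ-sameConfig : ∀ σ → Σ cfg (sameConfig q B σ) ≡ 1#
  Σ-sameConfig σ = trans (Σ-cong cfg as-indicator) (Σ-allFuns-point n σ (λ _ → 1#) (λ _ _ _ → refl))
    where
    as-indicator : ∀ τ → sameConfig q B σ τ ≡ 𝟙 (allᵇ (λ w → τ w == σ w) (allFin n)) * 1#
    as-indicator τ = trans ([]ᵇ≡𝟙 (allᵇ (λ w → σ w == τ w) (allFin n)))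
                       (trans (cong 𝟙 (allᵇ-cong (allFin n) (λ w → ==-sym (σ w) (τ w)))) (sym (*-identityʳ _)))

  -- The conditioned Ising measure π^{c,c'}_{H,u,v} on U = σ⁻¹(c,c'):
  -- resampleW is its unnormalised weight and D its normalising constant.

  pre : Config → Fin q → Fin q → Fin n → Bool
  pre = preimage2 q B

  valid : Config → Fin q → Fin q → Config → Bool
  valid σ c c' τ = allᵇ (λ w → if pre σ c c' w then ((τ w == c) ∨ (τ w == c')) else (τ w == σ w)) (allFin n)

  D : Config → Fin q → Fin q → Carrier
  D σ c c' = Σ cfg (resampleW q B adj σ u v c c')

  resampleW-ext : ∀ σ c c' → Ext (resampleW q B adj σ u v c c')
  resampleW-ext σ c c' τ τ' e =
    cong₂ _*_ (cong [_]ᵇ (cong₂ _∧_ (allᵇ-cong (allFin n) (λ w → cong (λ x → if pre σ c c' w then ((x == c) ∨ (x == c')) else (x == σ w)) (e w)))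
                                   (cong₂ _∧_ (cong (_== c) (e u)) (cong (_== c') (e v)))))
              (cong (B ^_) (monoIn-ext adj (pre σ c c') e))

  resampleW-nonneg : ∀ σ c c' τ → 0# ≤ resampleW q B adj σ u v c c' τ
  resampleW-nonneg σ c c' τ = *-nonneg _ _ (≤-resp refl (sym ([]ᵇ≡𝟙 b)) (𝟙-nonneg b)) (B^-nonneg (monoIn adj (pre σ c c') _==_ τ))
    where b = resampleValid q B σ u v c c' τ

  D-pos : ∀ σ c c' τ → resampleValid q B σ u v c c' τ ≡ true → 0# < D σ c c'
  D-pos σ c c' τ τ-valid = <-≤-trans (subst (0# <_) (sym weight) (^-pos 0<B (monoIn adj (pre σ c c') _==_ τ)))
      (Σ-allFuns-≥-point n _ (resampleW-ext σ c c') (resampleW-nonneg σ c c') τ)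
    where weight : resampleW q B adj σ u v c c' τ ≡ B ^ monoIn adj (pre σ c c') _==_ τ
          weight rewrite τ-valid = *-identityˡ _

  -- When σ u = σ v = c ≠ c', recolouring v by c' is admissible.
  D-pos-resample : ∀ σ c' → σ u ≡ σ v → c' ≢ σ u → 0# < D σ (σ u) c'
  D-pos-resample σ c' σu≡σv c'≢c = D-pos σ (σ u) c' τ₀ admissible
    where
    τ₀ : Config
    τ₀ w = if w == v then c' else σ w
    on-w : ∀ w → (if pre σ (σ u) c' w then ((τ₀ w == σ u) ∨ (τ₀ w == c')) else (τ₀ w == σ w)) ≡ true
    on-w w with ==-view w v
    ... | inj₁ (w=v , refl) rewrite w=v | sym σu≡σv | ==-refl (σ u) | ==-refl c' = ∨-trueʳ _
    ... | inj₂ (w≠v , _) rewrite w≠v with pre σ (σ u) c' w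
    ... | true = refl
    ... | false = ==-refl (σ w)
    admissible : resampleValid q B σ u v (σ u) c' τ₀ ≡ true
    admissible rewrite allᵇ-intro n _ on-w | ==-false u≢v | ==-refl (σ u) | ==-refl v | ==-refl c' = refl

  Σ-condIsing : ∀ σ c' → σ u ≡ σ v → c' ≢ σ u → Σ cfg (condIsing q B adj σ u v (σ u) c') ≡ 1#
  Σ-condIsing σ c' σu≡σv c'≢c = trans (Σ-*ʳ cfg (D σ (σ u) c' ⁻¹) (resampleW q B adj σ u v (σ u) c'))
                                      (⁻¹-inverse _ (pos⇒≢0 (D-pos-resample σ c' σu≡σv c'≢c)))

  -- IdealReSample: with probability `heads` keep σ, otherwise pick c' ≠ c
  -- with probability iQ = 1/(q−1) and resample from π^{c,c'}_{H,u,v}.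
  heads iQ : Carrier
  heads = (fromℕ q * B) / (B + fromℕ (q ∸ 1))
  iQ = 1# / fromℕ (q ∸ 1)

  Σ-otherColours : ∀ c (f : Fin q → Carrier) → Σ (otherColours {n} q B c) f ≡ Σ (allFin q) (λ x → 𝟙 (not (x == c)) * f x)
  Σ-otherColours c f = Σ-filter (λ c' → not (c' == c)) (allFin q) f

  count-otherColours : ∀ c → Σ (allFin q) (λ x → 𝟙 (not (x == c))) ≡ fromℕ q₁
  count-otherColours c = +-cancelʳ 1# _ _ (begin
    Σ (allFin q) (λ x → 𝟙 (not (x == c))) + 1#
      ≡⟨ cong (Σ (allFin q) (λ x → 𝟙 (not (x == c))) +_) (sym (Σ-δ q c (λ _ → 1#))) ⟩
    Σ (allFin q) (λ x → 𝟙 (not (x == c))) + Σ (allFin q) (λ x → 𝟙 (x == c) * 1#)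
      ≡⟨ sym (Σ-+ (allFin q) _ _) ⟩
    Σ (allFin q) (λ x → 𝟙 (not (x == c)) + 𝟙 (x == c) * 1#)
      ≡⟨ Σ-cong (allFin q) (λ x → complement (x == c)) ⟩
    Σ (allFin q) (λ _ → 1#)
      ≡⟨ trans (Σ-ones q) (+-comm 1# (fromℕ q₁)) ⟩
    fromℕ q₁ + 1# ∎)
    where
    complement : ∀ b → 𝟙 (not b) + 𝟙 b * 1# ≡ 1#
    complement true = trans (+-identityˡ _) (*-identityʳ _)
    complement false = trans (cong (1# +_) (zeroˡ 1#)) (+-identityʳ 1#)

  Σ-idealReSample : ∀ σ → σ u ≡ σ v → fromℕ q₁ ≢ 0# → Σ cfg (idealReSample q B adj u v σ) ≡ 1#
  Σ-idealReSample σ σu≡σv Q≢0 = begin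
    Σ cfg (idealReSample q B adj u v σ)
      ≡⟨ Σ-+ cfg _ _ ⟩
    Σ cfg (λ σ' → heads * sameConfig q B σ σ') + Σ cfg (λ σ' → (1# - heads) * tails σ')
      ≡⟨ cong₂ _+_ (trans (Σ-*ˡ cfg heads _) (trans (cong (heads *_) (Σ-sameConfig σ)) (*-identityʳ heads)))
                   (trans (Σ-*ˡ cfg (1# - heads) tails) (trans (cong ((1# - heads) *_) Σ-tails) (*-identityʳ _))) ⟩
    heads + (1# - heads)
      ≡⟨ trans (+-comm heads _) (trans (+-assoc 1# (- heads) heads) (trans (cong (1# +_) (-‿inverseˡ heads)) (+-identityʳ 1#))) ⟩
    1# ∎
    where
    c = σ u
    tails : Config → Carrier
    tails σ' = Σ (otherColours {n} q B c) (λ c' → iQ * condIsing q B adj σ u v c c' σ')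
    per-colour : ∀ x → 𝟙 (not (x == c)) * Σ cfg (λ σ' → iQ * condIsing q B adj σ u v c x σ') ≡ 𝟙 (not (x == c)) * iQ
    per-colour x with ==-view x c
    ... | inj₁ (x=c , _) rewrite x=c = trans (zeroˡ _) (sym (zeroˡ _))
    ... | inj₂ (x≠c , x≢c) rewrite x≠c =
      cong (1# *_) (trans (Σ-*ˡ cfg iQ _) (trans (cong (iQ *_) (Σ-condIsing σ x σu≡σv x≢c)) (*-identityʳ iQ)))
    Σ-tails : Σ cfg tails ≡ 1#
    Σ-tails = begin
      Σ cfg tails
        ≡⟨ Σ-swap cfg (otherColours {n} q B c) (λ σ' c' → iQ * condIsing q B adj σ u v c c' σ') ⟩
      Σ (otherColours {n} q B c) (λ c' → Σ cfg (λ σ' → iQ * condIsing q B adj σ u v c c' σ'))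
        ≡⟨ trans (Σ-otherColours c _) (Σ-cong (allFin q) per-colour) ⟩
      Σ (allFin q) (λ x → 𝟙 (not (x == c)) * iQ)
        ≡⟨ trans (Σ-*ʳ (allFin q) iQ _) (cong (_* iQ) (count-otherColours c)) ⟩
      fromℕ q₁ * iQ
        ≡⟨ trans (cong (fromℕ q₁ *_) (*-identityˡ _)) (⁻¹-inverse _ Q≢0) ⟩
      1# ∎

  K : Config → Config → Carrier
  K σ σ' = if σ u == σ v then idealReSample q B adj u v σ σ' else sameConfig q B σ σ'

  Σ-K : fromℕ q₁ ≢ 0# → ∀ σ → Σ cfg (K σ) ≡ 1#
  Σ-K Q≢0 σ with ==-view (σ u) (σ v)
  ... | inj₁ (eq , σu≡σv) rewrite eq = Σ-idealReSample σ σu≡σv Q≢0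
  ... | inj₂ (eq , _) rewrite eq = Σ-sameConfig σ

  Σν : fromℕ q₁ ≢ 0# → Σ cfg (ν q B adj u v) ≡ 1#
  Σν Q≢0 = begin
    Σ cfg (λ σ' → Σ cfg (λ σ → μ q B adj σ * K σ σ'))
      ≡⟨ Σ-swap cfg cfg (λ σ' σ → μ q B adj σ * K σ σ') ⟩
    Σ cfg (λ σ → Σ cfg (λ σ' → μ q B adj σ * K σ σ'))
      ≡⟨ Σ-cong cfg (λ σ → trans (Σ-*ˡ cfg (μ q B adj σ) (K σ)) (trans (cong (μ q B adj σ *_) (Σ-K Q≢0 σ)) (*-identityʳ _))) ⟩
    Σ cfg (μ q B adj)
      ≡⟨ Σμ adj ⟩
    1# ∎

-- The off-diagonal mass comes
-- from the σ with σ u = σ v = ς u that IdealReSample maps to ς; a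
-- detailed-balance identity turns μ_G(σ)·π_σ(ς) into μ_G(ς)·(weight of σ).
module ResamplingLaw (𝔽 : OrderedField) {n : ℕ} (q₁ : ℕ) (B : OrderedField.Carrier 𝔽) (0<B : OrderedField._<_ 𝔽 (OrderedField.0# 𝔽) B)
                     (adj : Fin n → Fin n → Bool) (u v : Fin n) (u≢v : u ≢ v) where
  open OrderedFieldFacts 𝔽
  open Potts 𝔽 hiding (Σ[_]_)
  open PottsModel 𝔽 q₁ B 0<B adj u v u≢v
  open EdgeCounts using (monoIn-cong; mono-recolour)
  open ≡-Reasoning

  stay : Config → Carrier
  stay σ = if σ u == σ v then heads else 1#

  tails : Config → Config → Carrier
  tails σ ς = Σ (otherColours {n} q B (σ u)) (λ c' → iQ * condIsing q B adj σ u v (σ u) c' ς)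

  K-split : ∀ σ ς → μ q B adj σ * K σ ς
                  ≡ (μ q B adj σ * stay σ) * sameConfig q B σ ς + (1# - heads) * (𝟙 (σ u == σ v) * (μ q B adj σ * tails σ ς))
  K-split σ ς with σ u == σ v
  ... | true = begin
    m * (heads * S + (1# - heads) * T)            ≡⟨ distribˡ m _ _ ⟩
    m * (heads * S) + m * ((1# - heads) * T)      ≡⟨ cong₂ _+_ (sym (*-assoc m heads S)) (x*[y*z]≡y*[x*z] m (1# - heads) T) ⟩
    (m * heads) * S + (1# - heads) * (m * T)      ≡⟨ cong (λ z → (m * heads) * S + (1# - heads) * z) (sym (*-identityˡ (m * T))) ⟩
    (m * heads) * S + (1# - heads) * (1# * (m * T)) ∎
    where
    m = μ q B adj σ
    S = sameConfig q B σ ς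
    T = tails σ ς
  ... | false = begin
    m * S                                         ≡⟨ cong (_* S) (sym (*-identityʳ m)) ⟩
    (m * 1#) * S                                  ≡⟨ sym (+-identityʳ _) ⟩
    (m * 1#) * S + 0#                             ≡⟨ cong ((m * 1#) * S +_) (sym (trans (cong ((1# - heads) *_) (zeroˡ _)) (zeroʳ _))) ⟩
    (m * 1#) * S + (1# - heads) * (0# * (m * T))  ∎
    where
    m = μ q B adj σ
    S = sameConfig q B σ ς
    T = tails σ ς

  Σ-stay : ∀ ς → Σ cfg (λ σ → (μ q B adj σ * stay σ) * sameConfig q B σ ς) ≡ μ q B adj ς * stay ς
  Σ-stay ς = trans (Σ-cong cfg (λ σ → trans (*-comm _ _) (cong (_* (μ q B adj σ * stay σ)) ([]ᵇ≡𝟙 (allᵇ (λ w → σ w == ς w) (allFin n))))))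
                   (Σ-allFuns-point n ς (λ σ → μ q B adj σ * stay σ) stay-ext)
    where stay-ext : Ext (λ σ → μ q B adj σ * stay σ)
          stay-ext σ σ' e = cong₂ (λ m b → m * (if b then heads else 1#)) (μ-ext adj σ σ' e) (cong₂ _==_ (e u) (e v))

  ∧∧-falseʳ : ∀ a b → (a ∧ b ∧ false) ≡ false
  ∧∧-falseʳ a b = trans (cong (a ∧_) (∧-falseʳ b)) (∧-falseʳ a)

  condIsing-invalid : ∀ σ c c' ς → resampleValid q B σ u v c c' ς ≡ false → condIsing q B adj σ u v c c' ς ≡ 0#
  condIsing-invalid σ c c' ς invalid rewrite invalid =
    trans (cong (_* (D σ c c' ⁻¹)) (zeroˡ (B ^ monoIn adj (pre σ c c') _==_ ς))) (zeroˡ _)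

  -- Among the colours c' ≠ σ u only c' = ς v can lead from σ to ς.
  tails-eval : ∀ σ ς → tails σ ς ≡ 𝟙 (not (ς v == σ u)) * (iQ * condIsing q B adj σ u v (σ u) (ς v) ς)
  tails-eval σ ς = trans (Σ-otherColours (σ u) _) (Σ-support₁ q (ς v) _ other-c')
    where
    other-c' : ∀ x → (ς v == x) ≡ false → 𝟙 (not (x == σ u)) * (iQ * condIsing q B adj σ u v (σ u) x ς) ≡ 0#
    other-c' x ςv≠x = trans (cong (λ z → 𝟙 (not (x == σ u)) * (iQ * z)) (condIsing-invalid σ (σ u) x ς invalid))
                            (trans (cong (𝟙 (not (x == σ u)) *_) (zeroʳ iQ)) (zeroʳ _))
      where invalid : resampleValid q B σ u v (σ u) x ς ≡ false
            invalid rewrite ςv≠x = ∧∧-falseʳ (valid σ (σ u) x ς) (ς u == σ u)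

  valid-sym : ∀ σ ς a b → valid σ a b ς ≡ valid ς a b σ
  valid-sym σ ς a b = allᵇ-cong (allFin n) pointwise
    where
    pointwise : ∀ w → (if pre σ a b w then ((ς w == a) ∨ (ς w == b)) else (ς w == σ w))
                    ≡ (if pre ς a b w then ((σ w == a) ∨ (σ w == b)) else (σ w == ς w))
    pointwise w with pre σ a b w in σw∈ | pre ς a b w in ςw∈
    ... | true | true = refl
    ... | true | false = sym (==-separate a b (σ w) (ς w) σw∈ ςw∈)
    ... | false | true = ==-separate a b (ς w) (σ w) ςw∈ σw∈
    ... | false | false = ==-sym (ς w) (σ w)

  valid-same-U : ∀ σ ς a b → valid σ a b ς ≡ true → ∀ w → pre σ a b w ≡ pre ς a b w
  valid-same-U σ ς a b ok w with pre σ a b w in σw∈ | allᵇ-elim n _ ok w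
  ... | true | ςw∈ = sym ςw∈
  ... | false | ςw=σw = trans (sym σw∈) (cong (λ c → (c == a) ∨ (c == b)) (sym (==-sound ςw=σw)))

  valid-agree : ∀ σ ς a b → valid σ a b ς ≡ true → ∀ w → pre ς a b w ≡ false → σ w ≡ ς w
  valid-agree σ ς a b ok w ςw∉ with pre σ a b w in σw∈ | allᵇ-elim n _ ok w
  ... | true | _ with trans (sym σw∈) (trans (valid-same-U σ ς a b ok w) ςw∉)
  ...   | ()
  valid-agree σ ς a b ok w ςw∉ | false | ςw=σw = sym (==-sound ςw=σw)

  D-cong : ∀ σ ς a b → valid σ a b ς ≡ true → D σ a b ≡ D ς a b
  D-cong σ ς a b ok = Σ-cong cfg (λ τ → cong₂ _*_ (cong (λ z → [ z ∧ ((τ u == a) ∧ (τ v == b)) ]ᵇ) (allᵇ-cong (allFin n) (same-test τ)))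
                                                 (cong (B ^_) (monoIn-cong adj _==_ _==_ τ τ (valid-same-U σ ς a b ok) (λ _ _ _ _ → refl))))
    where
    same-test : ∀ τ w → (if pre σ a b w then ((τ w == a) ∨ (τ w == b)) else (τ w == σ w))
                      ≡ (if pre ς a b w then ((τ w == a) ∨ (τ w == b)) else (τ w == ς w))
    same-test τ w rewrite valid-same-U σ ς a b ok w with pre ς a b w in ςw∈
    ... | true = refl
    ... | false = cong (τ w ==_) (valid-agree σ ς a b ok w ςw∈)

  -- Detailed balance for one resampling move σ → ς inside U:
  -- μ_G(σ)·B^{m_U(ς)}/D_σ = μ_G(ς)·B^{m_U(σ)}/D_ς.
  balance : ∀ σ ς a b → valid σ a b ς ≡ true →
    μ q B adj σ * (B ^ monoIn adj (pre σ a b) _==_ ς * D σ a b ⁻¹) ≡ μ q B adj ς * (B ^ monoIn adj (pre ς a b) _==_ σ * D ς a b ⁻¹)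
  balance σ ς a b ok = begin
    ((B ^ mono adj σ) * Zi) * (B ^ monoIn adj (pre σ a b) _==_ ς * D σ a b ⁻¹)
      ≡⟨ cong₂ (λ k d → ((B ^ mono adj σ) * Zi) * (B ^ k * d ⁻¹)) (monoIn-cong adj _==_ _==_ ς ς (valid-same-U σ ς a b ok) (λ _ _ _ _ → refl)) (D-cong σ ς a b ok) ⟩
    ((B ^ mono adj σ) * Zi) * (B ^ mU ς * Di)
      ≡⟨ *-solve 4 (λ x z y d → ((x ⊛ z) ⊛ (y ⊛ d)) ⊜ ((x ⊛ y) ⊛ (z ⊛ d))) refl (B ^ mono adj σ) Zi (B ^ mU ς) Di ⟩
    ((B ^ mono adj σ) * B ^ mU ς) * (Zi * Di)
      ≡⟨ cong (_* (Zi * Di)) (trans (sym (^-+ B (mono adj σ) (mU ς))) (trans (cong (B ^_) recoloured) (^-+ B (mono adj ς) (mU σ)))) ⟩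
    ((B ^ mono adj ς) * B ^ mU σ) * (Zi * Di)
      ≡⟨ *-solve 4 (λ x y z d → ((x ⊛ y) ⊛ (z ⊛ d)) ⊜ ((x ⊛ z) ⊛ (y ⊛ d))) refl (B ^ mono adj ς) (B ^ mU σ) Zi Di ⟩
    ((B ^ mono adj ς) * Zi) * (B ^ mU σ * Di) ∎
    where
    Zi = Z q B adj ⁻¹
    Di = D ς a b ⁻¹
    mU : Config → ℕ
    mU τ = monoIn adj (pre ς a b) _==_ τ
    recoloured : mono adj σ ℕ.+ mU ς ≡ mono adj ς ℕ.+ mU σ
    recoloured = mono-recolour adj σ ς (pre ς a b) a b (valid-same-U σ ς a b ok) (λ _ → refl) (valid-agree σ ς a b ok)

  -- Unnormalised Ising weights on U = ς⁻¹(a,b) (outside U frozen to ς)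
  -- with u ↦ a and v ↦ c; by definition D ς a b = IsingZ ς a b b.
  isingWeight : Config → Fin q → Fin q → Fin q → Config → Carrier
  isingWeight ς a b c τ = [ valid ς a b τ ∧ (τ u == a) ∧ (τ v == c) ]ᵇ * B ^ monoIn adj (pre ς a b) _==_ τ

  IsingZ : Config → Fin q → Fin q → Fin q → Carrier
  IsingZ ς a b c = Σ cfg (isingWeight ς a b c)

  arrivalCoef : Config → Carrier
  arrivalCoef ς = iQ * μ q B adj ς * D ς (ς u) (ς v) ⁻¹

  -- Arrival at ς from σ with σ u = ς u: both sides vanish unless ς is an
  -- admissible recolouring of σ, and then they agree by detailed balance.
  arrival-admissible : ∀ ς σ → let a = ς u ; b = ς v in
    𝟙 (a == σ v) * (μ q B adj σ * (1# * (iQ * (([ valid σ a b ς ∧ true ∧ true ]ᵇ * B ^ monoIn adj (pre σ a b) _==_ ς) * D σ a b ⁻¹))))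
      ≡ arrivalCoef ς * ([ valid ς a b σ ∧ true ∧ (σ v == a) ]ᵇ * B ^ monoIn adj (pre ς a b) _==_ σ)
  arrival-admissible ς σ with valid σ (ς u) (ς v) ς in ok | valid ς (ς u) (ς v) σ | valid-sym σ ς (ς u) (ς v)
  ... | false | .false | refl = begin
    𝟙 (a == σ v) * (m * (1# * (iQ * ((0# * X) * D σ a b ⁻¹))))
      ≡⟨ cong (λ z → 𝟙 (a == σ v) * (m * (1# * (iQ * z)))) (trans (cong (_* D σ a b ⁻¹) (zeroˡ X)) (zeroˡ _)) ⟩
    𝟙 (a == σ v) * (m * (1# * (iQ * 0#)))
      ≡⟨ trans (cong (λ z → 𝟙 (a == σ v) * (m * (1# * z))) (zeroʳ iQ)) (trans (cong (λ z → 𝟙 (a == σ v) * (m * z)) (zeroʳ 1#))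
               (trans (cong (𝟙 (a == σ v) *_) (zeroʳ m)) (zeroʳ _))) ⟩
    0#
      ≡⟨ sym (trans (cong (arrivalCoef ς *_) (zeroˡ Y)) (zeroʳ _)) ⟩
    arrivalCoef ς * (0# * Y) ∎
    where
    a = ς u
    b = ς v
    m = μ q B adj σ
    X = B ^ monoIn adj (pre σ a b) _==_ ς
    Y = B ^ monoIn adj (pre ς a b) _==_ σ
  ... | true | .true | refl = begin
    𝟙 (a == σ v) * (m * (1# * (iQ * ((1# * X) * D σ a b ⁻¹))))
      ≡⟨ cong (λ z → 𝟙 (a == σ v) * (m * z)) (trans (*-identityˡ _) (cong (λ z → iQ * (z * D σ a b ⁻¹)) (*-identityˡ X))) ⟩
    𝟙 (a == σ v) * (m * (iQ * (X * D σ a b ⁻¹)))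
      ≡⟨ cong (𝟙 (a == σ v) *_) (x*[y*z]≡y*[x*z] m iQ _) ⟩
    𝟙 (a == σ v) * (iQ * (m * (X * D σ a b ⁻¹)))
      ≡⟨ cong (λ z → 𝟙 (a == σ v) * (iQ * z)) (balance σ ς a b ok) ⟩
    𝟙 (a == σ v) * (iQ * (m' * (Y * D ς a b ⁻¹)))
      ≡⟨ *-solve 5 (λ i q m y d → (i ⊛ (q ⊛ (m ⊛ (y ⊛ d)))) ⊜ (((q ⊛ m) ⊛ d) ⊛ (i ⊛ y))) refl (𝟙 (a == σ v)) iQ m' Y (D ς a b ⁻¹) ⟩
    arrivalCoef ς * (𝟙 (a == σ v) * Y)
      ≡⟨ cong (λ z → arrivalCoef ς * (z * Y)) (trans (cong 𝟙 (==-sym a (σ v))) (sym ([]ᵇ≡𝟙 (σ v == a)))) ⟩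
    arrivalCoef ς * ([ σ v == a ]ᵇ * Y) ∎
    where
    a = ς u
    b = ς v
    m = μ q B adj σ
    m' = μ q B adj ς
    X = B ^ monoIn adj (pre σ a b) _==_ ς
    Y = B ^ monoIn adj (pre ς a b) _==_ σ

  arrival : ∀ ς σ → (ς u == ς v) ≡ false →
    𝟙 (σ u == σ v) * (μ q B adj σ * tails σ ς) ≡ arrivalCoef ς * isingWeight ς (ς u) (ς v) (ς u) σ
  arrival ς σ ςu≠ςv rewrite tails-eval σ ς with ==-view (σ u) (ς u)
  ... | inj₂ (σu≠ςu , _) rewrite σu≠ςu =
    trans (cong (λ z → 𝟙 (σ u == σ v) * (μ q B adj σ * (𝟙 (not (ς v == σ u)) * (iQ * z))))
                (condIsing-invalid σ (σ u) (ς v) ς (∧∧-falseʳ' (valid σ (σ u) (ς v) ς) (trans (==-sym (ς u) (σ u)) σu≠ςu))))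
          (trans (zero-chain _ _ _) (sym (trans (cong (λ b → arrivalCoef ς * ([ b ]ᵇ * Y)) (∧-falseʳ (valid ς (ς u) (ς v) σ)))
                                               (trans (cong (arrivalCoef ς *_) (zeroˡ Y)) (zeroʳ _)))))
    where
    Y = B ^ monoIn adj (pre ς (ς u) (ς v)) _==_ σ
    ∧∧-falseʳ' : ∀ a {b c} → b ≡ false → (a ∧ b ∧ c) ≡ false
    ∧∧-falseʳ' a refl = ∧-falseʳ a
    zero-chain : ∀ x y z → x * (y * (z * (iQ * 0#))) ≡ 0#
    zero-chain x y z = trans (cong (λ w → x * (y * (z * w))) (zeroʳ iQ)) (trans (cong (λ w → x * (y * w)) (zeroʳ z)) (trans (cong (x *_) (zeroʳ y)) (zeroʳ x)))
  ... | inj₁ (_ , σu≡ςu) = begin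
    𝟙 (σ u == σ v) * (m * (𝟙 (not (b == σ u)) * (iQ * condIsing q B adj σ u v (σ u) b ς)))
      ≡⟨ cong (λ c → 𝟙 (c == σ v) * (m * (𝟙 (not (b == c)) * (iQ * condIsing q B adj σ u v c b ς)))) σu≡ςu ⟩
    𝟙 (a == σ v) * (m * (𝟙 (not (b == a)) * (iQ * condIsing q B adj σ u v a b ς)))
      ≡⟨ cong₂ (λ t s → 𝟙 (a == σ v) * (m * (𝟙 (not t) * (iQ * (([ valid σ a b ς ∧ s ]ᵇ * X) * D σ a b ⁻¹)))))
               (trans (==-sym b a) ςu≠ςv) (cong₂ _∧_ (==-refl a) (==-refl b)) ⟩
    𝟙 (a == σ v) * (m * (1# * (iQ * (([ valid σ a b ς ∧ true ∧ true ]ᵇ * X) * D σ a b ⁻¹))))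
      ≡⟨ arrival-admissible ς σ ⟩
    arrivalCoef ς * ([ valid ς a b σ ∧ true ∧ (σ v == a) ]ᵇ * Y)
      ≡⟨ cong (λ t → arrivalCoef ς * ([ valid ς a b σ ∧ t ∧ (σ v == a) ]ᵇ * Y)) (sym (trans (cong (_== a) σu≡ςu) (==-refl a))) ⟩
    arrivalCoef ς * isingWeight ς a b a σ ∎
    where
    a = ς u
    b = ς v
    m = μ q B adj σ
    X = B ^ monoIn adj (pre σ a b) _==_ ς
    Y = B ^ monoIn adj (pre ς a b) _==_ σ

  arrived : Config → Carrier
  arrived ς = Σ cfg (λ σ → 𝟙 (σ u == σ v) * (μ q B adj σ * tails σ ς))

  ν-decomposition : ∀ ς → ν q B adj u v ς ≡ μ q B adj ς * stay ς + (1# - heads) * arrived ς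
  ν-decomposition ς = begin
    Σ cfg (λ σ → μ q B adj σ * K σ ς)
      ≡⟨ trans (Σ-cong cfg (λ σ → K-split σ ς)) (Σ-+ cfg _ _) ⟩
    Σ cfg (λ σ → (μ q B adj σ * stay σ) * sameConfig q B σ ς) + Σ cfg (λ σ → (1# - heads) * (𝟙 (σ u == σ v) * (μ q B adj σ * tails σ ς)))
      ≡⟨ cong₂ _+_ (Σ-stay ς) (Σ-*ˡ cfg (1# - heads) _) ⟩
    μ q B adj ς * stay ς + (1# - heads) * arrived ς ∎

  -- Resampling never produces ς u = ς v (v is recoloured by c' ≠ σ u).
  arrived-diag : ∀ ς → (ς u == ς v) ≡ true → arrived ς ≡ 0#
  arrived-diag ς ςu=ςv = Σ-zero cfg none
    where
    none : ∀ σ → 𝟙 (σ u == σ v) * (μ q B adj σ * tails σ ς) ≡ 0#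
    none σ rewrite tails-eval σ ς with ==-view (σ u) (ς u)
    ... | inj₁ (_ , σu≡ςu) rewrite σu≡ςu | ==-sym (ς v) (ς u) | ςu=ςv =
      trans (cong (λ z → 𝟙 (ς u == σ v) * (μ q B adj σ * z)) (zeroˡ _)) (trans (cong (𝟙 (ς u == σ v) *_) (zeroʳ _)) (zeroʳ _))
    ... | inj₂ (σu≠ςu , _) =
      trans (cong (λ z → 𝟙 (σ u == σ v) * (μ q B adj σ * (𝟙 (not (ς v == σ u)) * (iQ * z)))) (condIsing-invalid σ (σ u) (ς v) ς invalid))
            (trans (cong (λ z → 𝟙 (σ u == σ v) * (μ q B adj σ * (𝟙 (not (ς v == σ u)) * z))) (zeroʳ iQ))
              (trans (cong (λ z → 𝟙 (σ u == σ v) * (μ q B adj σ * z)) (zeroʳ _)) (trans (cong (𝟙 (σ u == σ v) *_) (zeroʳ _)) (zeroʳ _))))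
      where invalid : resampleValid q B σ u v (σ u) (ς v) ς ≡ false
            invalid rewrite ==-sym (ς u) (σ u) | σu≠ςu = ∧-falseʳ (valid σ (σ u) (ς v) ς)

  arrived-offdiag : ∀ ς → (ς u == ς v) ≡ false → arrived ς ≡ arrivalCoef ς * IsingZ ς (ς u) (ς v) (ς u)
  arrived-offdiag ς ςu≠ςv = trans (Σ-cong cfg (λ σ → arrival ς σ ςu≠ςv)) (Σ-*ˡ cfg (arrivalCoef ς) _)

  ν-diag : ∀ ς → (ς u == ς v) ≡ true → ν q B adj u v ς ≡ μ q B adj ς * heads
  ν-diag ς ςu=ςv = begin
    ν q B adj u v ς
      ≡⟨ ν-decomposition ς ⟩
    μ q B adj ς * stay ς + (1# - heads) * arrived ς
      ≡⟨ cong₂ (λ b z → μ q B adj ς * (if b then heads else 1#) + (1# - heads) * z) ςu=ςv (arrived-diag ς ςu=ςv) ⟩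
    μ q B adj ς * heads + (1# - heads) * 0#
      ≡⟨ trans (cong (μ q B adj ς * heads +_) (zeroʳ _)) (+-identityʳ _) ⟩
    μ q B adj ς * heads ∎

  ν-offdiag : ∀ ς → (ς u == ς v) ≡ false →
    ν q B adj u v ς ≡ μ q B adj ς * (1# + ((1# - heads) * iQ) * (IsingZ ς (ς u) (ς v) (ς u) * D ς (ς u) (ς v) ⁻¹))
  ν-offdiag ς ςu≠ςv = begin
    ν q B adj u v ς
      ≡⟨ ν-decomposition ς ⟩
    μ q B adj ς * stay ς + (1# - heads) * arrived ς
      ≡⟨ cong₂ (λ b z → μ q B adj ς * (if b then heads else 1#) + (1# - heads) * z) ςu≠ςv (arrived-offdiag ς ςu≠ςv) ⟩
    m * 1# + (1# - heads) * ((iQ * m * Di) * N)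
      ≡⟨ cong₂ _+_ refl (*-solve 5 (λ h i m d z → (h ⊛ (((i ⊛ m) ⊛ d) ⊛ z)) ⊜ (m ⊛ ((h ⊛ i) ⊛ (z ⊛ d)))) refl (1# - heads) iQ m Di N) ⟩
    m * 1# + m * (((1# - heads) * iQ) * (N * Di))
      ≡⟨ sym (distribˡ m 1# _) ⟩
    m * (1# + ((1# - heads) * iQ) * (N * Di)) ∎
    where
    m = μ q B adj ς
    Di = D ς (ς u) (ς v) ⁻¹
    N = IsingZ ς (ς u) (ς v) (ς u)

-- The ratio of the two Ising masses IsingZ ς a b a / IsingZ ς a b b is
-- the ratio π_{G[U]}(η_u = 1, η_v = 1) / π_{G[U]}(η_u = 1, η_v = 2) of
-- the statement: colourings of U = ς⁻¹(a,b) by {a,b} are in bijection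
-- with the boolean configurations η of isingConfigs U (a ↔ true).
module IsingRatio (𝔽 : OrderedField) {n : ℕ} (q₁ : ℕ) (B : OrderedField.Carrier 𝔽) (0<B : OrderedField._<_ 𝔽 (OrderedField.0# 𝔽) B)
                  (adj : Fin n → Fin n → Bool) (u v : Fin n) (u≢v : u ≢ v) where
  open OrderedFieldFacts 𝔽
  open Potts 𝔽 hiding (Σ[_]_)
  open PottsModel 𝔽 q₁ B 0<B adj u v u≢v
  open ResamplingLaw 𝔽 q₁ B 0<B adj u v u≢v
  open EdgeCounts using (monoIn-cong; monoIn-ext)
  open ≡-Reasoning

  choose : ∀ {k} (a b : Fin k) → Bool → Fin k
  choose a b y = if y then a else b

  choose-== : ∀ {k} (a b : Fin k) → (a == b) ≡ false → ∀ y y' → (choose a b y == choose a b y') ≡ boolEq y y'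
  choose-== a b a≠b true true = ==-refl a
  choose-== a b a≠b true false = a≠b
  choose-== a b a≠b false true = trans (==-sym b a) a≠b
  choose-== a b a≠b false false = ==-refl b

  coordinate : ∀ (a b : Fin q) → (a == b) ≡ false → ∀ (inU : Bool) (c : Fin q) (g : Fin q → Carrier) →
    Σ (allFin q) (λ x → 𝟙 (if inU then ((x == a) ∨ (x == b)) else (x == c)) * g x)
      ≡ Σ (true ∷ false ∷ []) (λ y → 𝟙 (inU ∨ not y) * g (if inU then choose a b y else c))
  coordinate a b a≠b true c g = begin
    Σ (allFin q) (λ x → 𝟙 ((x == a) ∨ (x == b)) * g x)
      ≡⟨ Σ-cong (allFin q) (λ x → trans (cong (_* g x) (𝟙-∨ (x == a) (x == b) (disjoint x))) (distribʳ (g x) _ _)) ⟩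
    Σ (allFin q) (λ x → 𝟙 (x == a) * g x + 𝟙 (x == b) * g x)
      ≡⟨ trans (Σ-+ (allFin q) _ _) (cong₂ _+_ (Σ-δ q a g) (Σ-δ q b g)) ⟩
    g a + g b
      ≡⟨ cong₂ _+_ (sym (*-identityˡ (g a))) (sym (trans (+-identityʳ _) (*-identityˡ (g b)))) ⟩
    1# * g a + (1# * g b + 0#) ∎
    where
    disjoint : ∀ x → ((x == a) ∧ (x == b)) ≡ false
    disjoint x with ==-view x a
    ... | inj₂ (x≠a , _) rewrite x≠a = refl
    ... | inj₁ (x=a , refl) rewrite x=a = a≠b
  coordinate a b a≠b false c g =
    trans (Σ-δ q c g) (sym (trans (cong₂ _+_ (zeroˡ _) (trans (+-identityʳ _) (*-identityˡ _))) (+-identityˡ _)))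

  module _ (ς : Config) (ςu≠ςv : (ς u == ς v) ≡ false) where
    a b : Fin q
    a = ς u
    b = ς v

    U : Fin n → Bool
    U = pre ς a b

    u∈U : U u ≡ true
    u∈U = cong (_∨ (ς u == ς v)) (==-refl (ς u))

    v∈U : U v ≡ true
    v∈U = trans (cong ((ς v == ς u) ∨_) (==-refl (ς v))) (∨-trueʳ _)

    decode : Fin n → Bool → Fin q
    decode w y = if U w then choose a b y else ς w

    decode-on-U : ∀ w → U w ≡ true → ∀ y → decode w y ≡ choose a b y
    decode-on-U w w∈U y rewrite w∈U = refl

    IsingZ-as-ising : ∀ bv → IsingZ ς a b (choose a b bv)
      ≡ Σ (isingConfigs {n} q B U) (λ η → [ boolEq (η u) true ∧ boolEq (η v) bv ]ᵇ * isingW q B adj U η)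
    IsingZ-as-ising bv = begin
      Σ cfg (isingWeight ς a b (choose a b bv))
        ≡⟨ Σ-cong cfg (λ τ → trans (cong (_* B ^ monoIn adj U _==_ τ) (trans ([]ᵇ≡𝟙 (valid ς a b τ ∧ ((τ u == a) ∧ (τ v == choose a b bv)))) (𝟙-∧ (valid ς a b τ) _))) (*-assoc _ _ _)) ⟩
      Σ cfg (λ τ → 𝟙 (valid ς a b τ) * F τ)
        ≡⟨ reindex n (allFin q) (true ∷ false ∷ []) (λ w x → if U w then ((x == a) ∨ (x == b)) else (x == ς w))
                   (λ w y → U w ∨ not y) decode (λ w g → coordinate a b ςu≠ςv (U w) (ς w) g) F F-ext ⟩
      Σ (allFuns n (true ∷ false ∷ [])) (λ η → 𝟙 (allᵇ (λ w → U w ∨ not (η w)) (allFin n)) * F (λ w → decode w (η w)))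
        ≡⟨ Σ-cong (allFuns n (true ∷ false ∷ [])) (λ η → cong (𝟙 (allᵇ (λ w → U w ∨ not (η w)) (allFin n)) *_) (F-decode η)) ⟩
      Σ (allFuns n (true ∷ false ∷ [])) (λ η → 𝟙 (allᵇ (λ w → U w ∨ not (η w)) (allFin n)) * ([ boolEq (η u) true ∧ boolEq (η v) bv ]ᵇ * isingW q B adj U η))
        ≡⟨ sym (Σ-filter (λ η → allᵇ (λ w → U w ∨ not (η w)) (allFin n)) (allFuns n (true ∷ false ∷ [])) _) ⟩
      Σ (isingConfigs {n} q B U) (λ η → [ boolEq (η u) true ∧ boolEq (η v) bv ]ᵇ * isingW q B adj U η) ∎
      where
      F : Config → Carrier
      F τ = 𝟙 ((τ u == a) ∧ (τ v == choose a b bv)) * B ^ monoIn adj U _==_ τ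
      F-ext : Ext F
      F-ext τ τ' e = cong₂ (λ x k → 𝟙 x * B ^ k) (cong₂ (λ x y → (x == a) ∧ (y == choose a b bv)) (e u) (e v)) (monoIn-ext adj U e)
      F-decode : ∀ η → F (λ w → decode w (η w)) ≡ [ boolEq (η u) true ∧ boolEq (η v) bv ]ᵇ * isingW q B adj U η
      F-decode η = cong₂ _*_
        (trans (cong₂ (λ x y → 𝟙 ((x == a) ∧ (y == choose a b bv))) (decode-on-U u u∈U (η u)) (decode-on-U v v∈U (η v)))
          (trans (cong₂ (λ x y → 𝟙 (x ∧ y)) (choose-== a b ςu≠ςv (η u) true) (choose-== a b ςu≠ςv (η v) bv))
            (sym ([]ᵇ≡𝟙 (boolEq (η u) true ∧ boolEq (η v) bv)))))
        (cong (B ^_) (monoIn-cong adj _==_ boolEq (λ w → decode w (η w)) η (λ _ → refl)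
           (λ i j i∈U j∈U → trans (cong₂ _==_ (decode-on-U i i∈U (η i)) (decode-on-U j j∈U (η j))) (choose-== a b ςu≠ςv (η i) (η j)))))

    -- ς itself is an admissible recolouring, so D ς a b > 0.
    D-pos-self : 0# < D ς a b
    D-pos-self = D-pos ς a b ς admissible
      where
      on-w : ∀ w → (if U w then ((ς w == a) ∨ (ς w == b)) else (ς w == ς w)) ≡ true
      on-w w with U w in w∈U
      ... | true = refl
      ... | false = ==-refl (ς w)
      admissible : resampleValid q B ς u v a b ς ≡ true
      admissible rewrite allᵇ-intro n _ on-w | ==-refl (ς u) | ==-refl (ς v) = refl

    ising-total : Carrier
    ising-total = Σ (isingConfigs {n} q B U) (isingW q B adj U)

    ising-total-pos : 0# < ising-total
    ising-total-pos = <-≤-trans (subst (0# <_) (IsingZ-as-ising false) D-pos-self)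
      (Σ-mono (isingConfigs {n} q B U) _ _
        (λ η → ≤-resp (cong (_* isingW q B adj U η) (sym ([]ᵇ≡𝟙 (boolEq (η u) true ∧ boolEq (η v) false)))) refl
                      (𝟙*x≤x (boolEq (η u) true ∧ boolEq (η v) false) _ (B^-nonneg (monoIn adj U boolEq η)))))

    ising-ratio : IsingZ ς a b a * D ς a b ⁻¹ ≡ πUV q B adj U u v true true / πUV q B adj U u v true false
    ising-ratio = begin
      IsingZ ς a b a * IsingZ ς a b b ⁻¹
        ≡⟨ sym (/-cancel _ _ ising-total (pos⇒≢0 D-pos-self) (pos⇒≢0 ising-total-pos)) ⟩
      (IsingZ ς a b a * ising-total ⁻¹) * (IsingZ ς a b b * ising-total ⁻¹) ⁻¹
        ≡⟨ cong₂ (λ x y → (x * ising-total ⁻¹) * (y * ising-total ⁻¹) ⁻¹) (IsingZ-as-ising true) (IsingZ-as-ising false) ⟩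
      πUV q B adj U u v true true / πUV q B adj U u v true false ∎

-- The constants of IdealReSample: with Q = q − 1 and s = B + Q,
-- heads = qB/s and γ = (1 − heads)/Q = (1 − B)/s, so that
-- (1 + γ)·B = heads and 0 ≤ γ ≤ 1 when 0 < B ≤ 1.
module ResampleConstants (𝔽 : OrderedField) (q₁ : ℕ) (q₁≥1 : q₁ ≥ 1) (B : OrderedField.Carrier 𝔽)
                         (0<B : OrderedField._<_ 𝔽 (OrderedField.0# 𝔽) B) (B≤1 : OrderedField._≤_ 𝔽 B (OrderedField.1# 𝔽)) where
  open OrderedFieldFacts 𝔽
  open ≡-Reasoning

  Q s heads iQ γ : Carrier
  Q = fromℕ q₁
  s = B + Q
  heads = (fromℕ (suc q₁) * B) / s
  iQ = 1# / Q
  γ = (1# - heads) * iQ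

  1≤Q : 1# ≤ Q
  1≤Q = fromℕ-≥1 q₁ q₁≥1

  0<Q : 0# < Q
  0<Q = <-≤-trans 0<1 1≤Q

  0<s : 0# < s
  0<s = subst (0# <_) (+-comm Q B) (<-≤-trans 0<Q (≤-resp (+-identityʳ Q) refl (+-monoʳ-≤ Q (proj₁ 0<B))))

  qB≡B+QB : fromℕ (suc q₁) * B ≡ B + Q * B
  qB≡B+QB = trans (distribʳ B 1# Q) (cong (_+ Q * B) (*-identityˡ B))

  heads*s : heads * s ≡ B + Q * B
  heads*s = trans (x*y⁻¹*y≡x _ s (pos⇒≢0 0<s)) qB≡B+QB

  tails*s : (1# - heads) * s ≡ Q * (1# - B)
  tails*s = begin
    (1# + - heads) * s              ≡⟨ distribʳ s 1# (- heads) ⟩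
    1# * s + (- heads) * s          ≡⟨ cong₂ _+_ (*-identityˡ s) (sym (-‿distribˡ-* heads s)) ⟩
    (B + Q) + - (heads * s)         ≡⟨ cong (λ z → (B + Q) + - z) heads*s ⟩
    (B + Q) + - (B + Q * B)         ≡⟨ cong ((B + Q) +_) (sym (-‿+-comm B (Q * B))) ⟩
    (B + Q) + (- B + - (Q * B))     ≡⟨ +-solve 4 (λ b q nb nqb → ((b ⊞ q) ⊞ (nb ⊞ nqb)) ⊜⁺ ((b ⊞ nb) ⊞ (q ⊞ nqb))) refl B Q (- B) (- (Q * B)) ⟩
    (B + - B) + (Q + - (Q * B))     ≡⟨ trans (cong (_+ (Q + - (Q * B))) (-‿inverseʳ B)) (+-identityˡ _) ⟩
    Q + - (Q * B)                   ≡⟨ cong₂ _+_ (sym (*-identityʳ Q)) (-‿distribʳ-* Q B) ⟩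
    Q * 1# + Q * (- B)              ≡⟨ sym (distribˡ Q 1# (- B)) ⟩
    Q * (1# - B)                    ∎

  γ*s : γ * s ≡ 1# - B
  γ*s = begin
    ((1# - heads) * iQ) * s         ≡⟨ *-solve 3 (λ t i s → ((t ⊛ i) ⊛ s) ⊜ (i ⊛ (t ⊛ s))) refl (1# - heads) iQ s ⟩
    iQ * ((1# - heads) * s)         ≡⟨ cong (iQ *_) tails*s ⟩
    iQ * (Q * (1# - B))             ≡⟨ sym (*-assoc iQ Q _) ⟩
    (iQ * Q) * (1# - B)             ≡⟨ cong (_* (1# - B)) (trans (cong (_* Q) (*-identityˡ _)) (⁻¹-inverseˡ Q (pos⇒≢0 0<Q))) ⟩
    1# * (1# - B)                   ≡⟨ *-identityˡ _ ⟩
    1# - B                          ∎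

  -- (1 + γ)·B = heads: on the diagonal σ u = σ v the Potts weight gains a
  -- factor B when the edge uv is added, and IdealReSample keeps mass heads.
  [1+γ]*B≡heads : (1# + γ) * B ≡ heads
  [1+γ]*B≡heads = *-cancelʳ s (pos⇒≢0 0<s) (begin
    ((1# + γ) * B) * s              ≡⟨ *-solve 3 (λ k b s → ((k ⊛ b) ⊛ s) ⊜ (b ⊛ (k ⊛ s))) refl (1# + γ) B s ⟩
    B * ((1# + γ) * s)              ≡⟨ cong (B *_) (trans (distribʳ s 1# γ) (cong₂ _+_ (*-identityˡ s) γ*s)) ⟩
    B * ((B + Q) + (1# + - B))      ≡⟨ cong (B *_) (+-solve 4 (λ b q o nb → ((b ⊞ q) ⊞ (o ⊞ nb)) ⊜⁺ ((b ⊞ nb) ⊞ (o ⊞ q))) refl B Q 1# (- B)) ⟩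
    B * ((B + - B) + (1# + Q))      ≡⟨ cong (λ z → B * (z + (1# + Q))) (-‿inverseʳ B) ⟩
    B * (0# + (1# + Q))             ≡⟨ cong (B *_) (+-identityˡ _) ⟩
    B * fromℕ (suc q₁)              ≡⟨ *-comm B _ ⟩
    fromℕ (suc q₁) * B              ≡⟨ sym (x*y⁻¹*y≡x _ s (pos⇒≢0 0<s)) ⟩
    heads * s                       ∎)

  heads≤1 : heads ≤ 1#
  heads≤1 = ≤-resp refl (⁻¹-inverse s (pos⇒≢0 0<s)) (*-monoʳ-≤ (s ⁻¹) (⁻¹-nonneg 0<s) qB≤s)
    where qB≤s : fromℕ (suc q₁) * B ≤ s
          qB≤s = ≤-resp (sym qB≡B+QB) refl (+-monoʳ-≤ B (≤-resp refl (*-identityʳ Q) (*-monoˡ-≤ Q (proj₁ 0<Q) B≤1)))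

  0≤iQ : 0# ≤ iQ
  0≤iQ = *-nonneg _ _ 0≤1 (⁻¹-nonneg 0<Q)

  0≤γ : 0# ≤ γ
  0≤γ = *-nonneg _ _ (≤⇒0≤- heads≤1) 0≤iQ

  γ≤1 : γ ≤ 1#
  γ≤1 = ≤-trans (*-monoʳ-≤ iQ 0≤iQ tails≤1) (≤-resp (sym (*-identityˡ iQ)) refl iQ≤1)
    where
    0≤heads : 0# ≤ heads
    0≤heads = *-nonneg _ _ (*-nonneg _ _ (fromℕ-nonneg (suc q₁)) (proj₁ 0<B)) (⁻¹-nonneg 0<s)
    tails≤1 : 1# - heads ≤ 1#
    tails≤1 = ≤-resp refl (+-identityʳ 1#) (+-monoʳ-≤ 1# (0≤⇒-≤0 0≤heads))
    iQ≤1 : iQ ≤ 1#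
    iQ≤1 = ≤-resp refl (⁻¹-inverse Q (pos⇒≢0 0<Q)) (*-monoʳ-≤ (Q ⁻¹) (⁻¹-nonneg 0<Q) 1≤Q)

-- ℓ¹ distance of two measures of equal mass whose difference is a
-- multiple of a nonnegative function plus an error term e: the multiple
-- is forced to balance e, so Σ|p − p'| ≤ 2·Σ|e|.
module EqualMassPerturbation (𝔽 : OrderedField) where
  open OrderedFieldFacts 𝔽
  open ≡-Reasoning

  Σ∣p-p'∣≤2Σ∣e∣ : ∀ {X : Set} (xs : List X) (p p' a e : X → Carrier) (A : Carrier) →
    Σ xs p ≡ Σ xs p' → (∀ x → 0# ≤ a x) → (∀ x → p x - p' x ≡ A * a x + e x) →
    Σ xs (λ x → ∣ p x - p' x ∣) ≤ Σ xs (λ x → ∣ e x ∣) + Σ xs (λ x → ∣ e x ∣)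
  Σ∣p-p'∣≤2Σ∣e∣ xs p p' a e A same-mass 0≤a split =
    ≤-trans (≤-reflexive (Σ-cong xs (λ x → cong ∣_∣ (split x))))
      (≤-trans (Σ-mono xs _ _ (λ x → ∣∣-triangle (A * a x) (e x)))
        (≤-resp (sym (Σ-+ xs (λ x → ∣ A * a x ∣) (λ x → ∣ e x ∣))) refl
                (+-mono-≤ _ _ (Σ xs (λ x → ∣ e x ∣)) multiple≤Σ∣e∣)))
    where
    Σa = Σ xs a
    balanced : A * Σa ≡ - Σ xs e
    balanced = +-inverseʳ-unique (Σ xs e) (A * Σa) (begin
      Σ xs e + A * Σa                              ≡⟨ +-comm _ _ ⟩
      A * Σa + Σ xs e                              ≡⟨ cong (_+ Σ xs e) (sym (Σ-*ˡ xs A a)) ⟩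
      Σ xs (λ x → A * a x) + Σ xs e                ≡⟨ sym (Σ-+ xs _ e) ⟩
      Σ xs (λ x → A * a x + e x)                   ≡⟨ Σ-cong xs (λ x → sym (split x)) ⟩
      Σ xs (λ x → p x + - p' x)                    ≡⟨ trans (Σ-+ xs p (λ x → - p' x)) (cong (Σ xs p +_) (Σ-neg xs p')) ⟩
      Σ xs p + - Σ xs p'                           ≡⟨ trans (cong (_+ - Σ xs p') same-mass) (-‿inverseʳ _) ⟩
      0# ∎)
    multiple≤Σ∣e∣ : Σ xs (λ x → ∣ A * a x ∣) ≤ Σ xs (λ x → ∣ e x ∣)
    multiple≤Σ∣e∣ = ≤-resp (sym (begin
        Σ xs (λ x → ∣ A * a x ∣)     ≡⟨ Σ-cong xs (λ x → trans (cong ∣_∣ (*-comm A (a x))) (∣c*x∣≡c*∣x∣ (a x) A (0≤a x))) ⟩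
        Σ xs (λ x → a x * ∣ A ∣)     ≡⟨ Σ-*ʳ xs ∣ A ∣ a ⟩
        Σa * ∣ A ∣                   ≡⟨ sym (∣c*x∣≡c*∣x∣ Σa A (Σ-nonneg xs a 0≤a)) ⟩
        ∣ Σa * A ∣                   ≡⟨ cong ∣_∣ (trans (*-comm Σa A) balanced) ⟩
        ∣ - Σ xs e ∣                 ≡⟨ ∣-x∣≡∣x∣ _ ⟩
        ∣ Σ xs e ∣                   ∎)) refl (Σ-∣∣ xs e)

-- The main estimate: with m = μ_G, f(σ) = B^[σ u = σ v] and
-- d(σ) = [σ u ≠ σ v]·(ρ(σ) − 1) for the correlation ratio ρ(σ) on U_σ,
--   μ_{G'} = (Z_G/Z_{G'})·m·f   and   ν = m·((1 + γ)·f + γ·d),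
-- so ν − μ_{G'} is a multiple of m·f plus the error γ·m·d, whose ℓ¹ norm
-- is at most E[Corr_G(U_σ,u,v)].
module MainBound (𝔽 : OrderedField) (q₁ : ℕ) (q₁≥1 : q₁ ≥ 1) (B : OrderedField.Carrier 𝔽)
                 (0<B : OrderedField._<_ 𝔽 (OrderedField.0# 𝔽) B) (B≤1 : OrderedField._≤_ 𝔽 B (OrderedField.1# 𝔽))
                 {n : ℕ} (G : Graph n) (u v : Fin n) (u≢v : u ≢ v) (uv∉G : Graph.adj G u v ≡ false) where
  open OrderedFieldFacts 𝔽
  open Potts 𝔽 hiding (Σ[_]_)
  open PottsModel 𝔽 q₁ B 0<B (Graph.adj G) u v u≢v
  open ResamplingLaw 𝔽 q₁ B 0<B (Graph.adj G) u v u≢v using (ν-diag; ν-offdiag; IsingZ)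
  open IsingRatio 𝔽 q₁ B 0<B (Graph.adj G) u v u≢v using (ising-ratio)
  open ResampleConstants 𝔽 q₁ q₁≥1 B 0<B B≤1 using (γ; [1+γ]*B≡heads; 0≤γ; γ≤1)
  open EdgeCounts.AddEdge G u v u≢v uv∉G using (mono-addEdge)
  open EqualMassPerturbation 𝔽
  open ≡-Reasoning

  adj adj' : Fin n → Fin n → Bool
  adj = Graph.adj G
  adj' = addEdgeAdj adj u v

  gain : Config → ℕ
  gain σ = FiniteSums.𝟙 EdgeCounts.ℕ-semiring (σ u == σ v)

  m f ρ d : Config → Carrier
  m σ = μ q B adj σ
  f σ = B ^ gain σ
  ρ σ = πUV q B adj (pre σ (σ u) (σ v)) u v true true / πUV q B adj (pre σ (σ u) (σ v)) u v true false
  d σ = 𝟙 (not (σ u == σ v)) * (ρ σ - 1#)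

  Zr : Carrier
  Zr = Z q B adj * Z q B adj' ⁻¹

  μ'-factor : ∀ σ → μ q B adj' σ ≡ (m σ * f σ) * Zr
  μ'-factor σ = begin
    B ^ mono adj' σ * Z' ⁻¹
      ≡⟨ cong (λ k → B ^ k * Z' ⁻¹) (mono-addEdge σ) ⟩
    B ^ (mono adj σ ℕ.+ gain σ) * Z' ⁻¹
      ≡⟨ cong (_* Z' ⁻¹) (^-+ B (mono adj σ) (gain σ)) ⟩
    (B ^ mono adj σ * f σ) * Z' ⁻¹
      ≡⟨ cong (λ z → (z * f σ) * Z' ⁻¹) (sym (x*y⁻¹*y≡x (B ^ mono adj σ) (Z q B adj) (Z≢0 adj))) ⟩
    ((m σ * Z q B adj) * f σ) * Z' ⁻¹
      ≡⟨ *-solve 4 (λ m z f z' → (((m ⊛ z) ⊛ f) ⊛ z') ⊜ ((m ⊛ f) ⊛ (z ⊛ z'))) refl (m σ) (Z q B adj) (f σ) (Z' ⁻¹) ⟩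
    (m σ * f σ) * Zr ∎
    where Z' = Z q B adj'

  ν-closed : ∀ σ → ν q B adj u v σ ≡ m σ * ((1# + γ) * f σ + γ * d σ)
  ν-closed σ with σ u == σ v in σu=σv
  ... | true = begin
    ν q B adj u v σ
      ≡⟨ ν-diag σ σu=σv ⟩
    m σ * heads
      ≡⟨ cong (m σ *_) (sym [1+γ]*B≡heads) ⟩
    m σ * ((1# + γ) * B)
      ≡⟨ cong (m σ *_) (sym (trans (cong₂ _+_ (cong ((1# + γ) *_) (*-identityʳ B)) (trans (cong (γ *_) (zeroˡ _)) (zeroʳ γ))) (+-identityʳ _))) ⟩
    m σ * ((1# + γ) * (B * 1#) + γ * (0# * (ρ σ - 1#))) ∎
  ... | false = begin
    ν q B adj u v σ                           ≡⟨ ν-offdiag σ σu=σv ⟩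
    m σ * (1# + γ * (N * Di))                 ≡⟨ cong (λ r → m σ * (1# + γ * r)) (ising-ratio σ σu=σv) ⟩
    m σ * (1# + γ * ρ σ)                      ≡⟨ cong (m σ *_) rearrange ⟩
    m σ * ((1# + γ) * 1# + γ * (1# * (ρ σ - 1#))) ∎
    where
    N = IsingZ σ (σ u) (σ v) (σ u)
    Di = D σ (σ u) (σ v) ⁻¹
    rearrange : 1# + γ * ρ σ ≡ (1# + γ) * 1# + γ * (1# * (ρ σ - 1#))
    rearrange = sym (begin
      (1# + γ) * 1# + γ * (1# * (ρ σ - 1#))
        ≡⟨ cong₂ (λ x y → x + γ * y) (*-identityʳ _) (*-identityˡ _) ⟩
      (1# + γ) + γ * (ρ σ + - 1#)
        ≡⟨ cong ((1# + γ) +_) (trans (distribˡ γ (ρ σ) (- 1#)) (cong (γ * ρ σ +_) (trans (sym (-‿distribʳ-* γ 1#)) (cong -_ (*-identityʳ γ))))) ⟩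
      (1# + γ) + (γ * ρ σ + - γ)
        ≡⟨ +-solve 4 (λ o g r ng → ((o ⊞ g) ⊞ (r ⊞ ng)) ⊜⁺ ((o ⊞ r) ⊞ (g ⊞ ng))) refl 1# γ (γ * ρ σ) (- γ) ⟩
      (1# + γ * ρ σ) + (γ + - γ)
        ≡⟨ trans (cong ((1# + γ * ρ σ) +_) (-‿inverseʳ γ)) (+-identityʳ _) ⟩
      1# + γ * ρ σ                                ∎)

  ν-μ'-split : ∀ σ → ν q B adj u v σ - μ q B adj' σ ≡ ((1# + γ) - Zr) * (m σ * f σ) + γ * (m σ * d σ)
  ν-μ'-split σ = begin
    ν q B adj u v σ - μ q B adj' σ
      ≡⟨ cong₂ (λ x y → x + - y) (ν-closed σ) (μ'-factor σ) ⟩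
    m σ * (k * f σ + γ * d σ) + - ((m σ * f σ) * Zr)
      ≡⟨ cong₂ (λ x y → x + - y) (distribˡ (m σ) _ _) (*-comm _ Zr) ⟩
    (m σ * (k * f σ) + m σ * (γ * d σ)) + - (Zr * (m σ * f σ))
      ≡⟨ cong₂ (λ x y → (x + y) + - (Zr * (m σ * f σ))) (x*[y*z]≡y*[x*z] (m σ) k (f σ)) (x*[y*z]≡y*[x*z] (m σ) γ (d σ)) ⟩
    (k * (m σ * f σ) + γ * (m σ * d σ)) + - (Zr * (m σ * f σ))
      ≡⟨ +-solve 3 (λ x y z → ((x ⊞ y) ⊞ z) ⊜⁺ ((x ⊞ z) ⊞ y)) refl _ _ _ ⟩
    (k * (m σ * f σ) + - (Zr * (m σ * f σ))) + γ * (m σ * d σ)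
      ≡⟨ cong (_+ γ * (m σ * d σ)) (trans (cong (k * (m σ * f σ) +_) (-‿distribˡ-* Zr _)) (sym (distribʳ _ k (- Zr)))) ⟩
    (k - Zr) * (m σ * f σ) + γ * (m σ * d σ) ∎
    where k = 1# + γ

  error≤corr : ∀ σ → ∣ γ * (m σ * d σ) ∣
    ≤ μ q B adj σ * (if σ u == σ v
        then Σ (otherColours {n} q B (σ u)) (λ c' → (1# / fromℕ (q ∸ 1)) * Corr q B adj (pre σ (σ u) c') u v)
        else Corr q B adj (pre σ (σ u) (σ v)) u v)
  error≤corr σ with σ u == σ v
  ... | true = ≤-resp (sym (trans (cong ∣_∣ (trans (cong (λ z → γ * (m σ * z)) (zeroˡ _)) (trans (cong (γ *_) (zeroʳ (m σ))) (zeroʳ γ))))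
                                  (∣∣-nonneg 0# ≤-refl))) refl
                 (*-nonneg _ _ (μ-nonneg adj σ) (Σ-nonneg (otherColours {n} q B (σ u)) _ (λ c' → *-nonneg _ _ 0≤iQ' (∣x∣-nonneg _))))
    where 0≤iQ' : 0# ≤ 1# / fromℕ q₁
          0≤iQ' = *-nonneg _ _ 0≤1 (⁻¹-nonneg (<-≤-trans 0<1 (fromℕ-≥1 q₁ q₁≥1)))
  ... | false = ≤-resp (sym (begin
      ∣ γ * (m σ * (1# * (ρ σ - 1#))) ∣
        ≡⟨ ∣c*x∣≡c*∣x∣ γ _ 0≤γ ⟩
      γ * ∣ m σ * (1# * (ρ σ - 1#)) ∣
        ≡⟨ cong (γ *_) (trans (∣c*x∣≡c*∣x∣ (m σ) _ (μ-nonneg adj σ)) (cong (λ z → m σ * ∣ z ∣) (*-identityˡ _))) ⟩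
      γ * (m σ * ∣ ρ σ - 1# ∣) ∎)) refl
      (≤-resp refl (*-identityˡ _) (*-monoʳ-≤ (m σ * ∣ ρ σ - 1# ∣) (*-nonneg _ _ (μ-nonneg adj σ) (∣x∣-nonneg _)) γ≤1))

  dTV≤ECorr : dTV q B (ν q B adj u v) (μ q B adj') ≤ ECorr q B adj u v
  dTV≤ECorr = ≤-trans (*-monoˡ-≤ (1# / fromℕ 2) 0≤½ ℓ¹-bound) (≤-trans (≤-reflexive (½*[x+x]≡x error)) (Σ-mono cfg _ _ error≤corr))
    where
    error : Carrier
    error = Σ cfg (λ σ → ∣ γ * (m σ * d σ) ∣)
    0≤½ : 0# ≤ 1# / fromℕ 2
    0≤½ = *-nonneg _ _ 0≤1 (⁻¹-nonneg 0<2)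
    ℓ¹-bound : Σ cfg (λ σ → ∣ ν q B adj u v σ - μ q B adj' σ ∣) ≤ error + error
    ℓ¹-bound = Σ∣p-p'∣≤2Σ∣e∣ cfg (ν q B adj u v) (μ q B adj') (λ σ → m σ * f σ) (λ σ → γ * (m σ * d σ)) ((1# + γ) - Zr)
                 (trans (Σν Q≢0) (sym (Σμ adj'))) (λ σ → *-nonneg _ _ (μ-nonneg adj σ) (B^-nonneg (gain σ))) ν-μ'-split
      where Q≢0 = pos⇒≢0 (<-≤-trans 0<1 (fromℕ-≥1 q₁ q₁≥1))

-- Lemma 6.9.  The total variation distance is at most E[Corr] ≤ ε, and
-- ε ≤ 2ε/B because B ≤ 1.
lemma6p9 : (𝔽 : OrderedField) → let open OrderedField 𝔽 in let open Potts 𝔽 in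
    (B : Carrier) → 0# < B → B < 1# →
    (q : ℕ) → q ≥ 3 →
    (ε : Carrier) → 0# < ε → ε < 1# →
    (n : ℕ) (G : Graph n) (u v : Fin n) → u ≢ v → Graph.adj G u v ≡ false →
    ECorr q B (Graph.adj G) u v ≤ ε →
    dTV q B (ν q B (Graph.adj G) u v) (μ q B (addEdgeAdj (Graph.adj G) u v))
      ≤ (fromℕ 2 * ε) / B
lemma6p9 𝔽 B 0<B B<1 (suc q₁) (s≤s q₁≥2) ε 0<ε _ n G u v u≢v uv∉G ECorr≤ε =
  ≤-trans dTV≤ECorr (≤-trans ECorr≤ε (x≤2x/B (proj₁ 0<ε) 0<B (proj₁ B<1)))
  where
  open OrderedFieldFacts 𝔽 using (≤-trans; x≤2x/B)
  open MainBound 𝔽 q₁ (ℕₚ.≤-trans (s≤s z≤n) q₁≥2) B 0<B (proj₁ B<1) G u v u≢v uv∉G using (dTV≤ECorr)
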